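{- Let $\varphi$ be a $\mathrm{D}$-formula. There exists a homogeneous fulfilling compass $\varphi$-structure that features $\varphi$ if and only if there exist two initialized minimal $\varphi$-rows $row_1,row_2$ such that (1) $|row_1|=1$ and $\varphi\in row_2[i]$ for some $0\le i<|row_2|$, and (2) $row_2$ is reachable from $row_1$ in the finite graph $G^{min}_\varphi$.
   Context: Formulas: $\varphi ::= p\mid\neg\varphi\mid\varphi\vee\varphi\mid\langle D\rangle\varphi$, $p\in\mathcal{AP}$ (finite); $[D]\psi:=\neg\langle D\rangle\neg\psi$. $\mathrm{CL}(\varphi)$ is the set of subformulas of $\varphi$ and their negations, identifying $\neg\neg\psi$ with $\psi$ and $\neg\langle D\rangle\psi$ with $[D]\neg\psi$. A $\varphi$-atom is $A\subseteq\mathrm{CL}(\varphi)$ such that for all $\psi\in\mathrm{CL}(\varphi)$, $\psi\in A$ iff $\neg\psi\notin A$, and for all $\psi_1\vee\psi_2\in\mathrm{CL}(\varphi)$, $\psi_1\vee\psi_2\in A$ iff $\psi_1\in A$ or $\psi_2\in A$. $\mathcal{R}eq_D(A)=\{\psi:\langle D\rangle\psi\in A\}$, $\mathrm{REQ}_\varphi=\{\psi:\langle D\rangle\psi\in\mathrm{CL}(\varphi)\}$, $\mathcal{O}bs_D(A)=A\cap\mathrm{REQ}_\varphi$. $A\,D_\varphi\,A'$ iff for every $[D]\psi\in A$, both $\psi\in A'$ and $[D]\psi\in A'$. Generation: $A_1A_2\Rightarrow A_3$ iff $A_3\cap\mathcal{AP}=A_1\cap A_2\cap\mathcal{AP}$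 and $\mathcal{R}eq_D(A_3)=\mathcal{R}eq_D(A_1)\cup\mathcal{R}eq_D(A_2)\cup\mathcal{O}bs_D(A_1)\cup\mathcal{O}bs_D(A_2)$. A $\varphi$-row is a nonempty finite sequence $row=row[0]\cdots row[n-1]$ of $\varphi$-atoms with $row[i+1]\,D_\varphi\,row[i]$ and $row[i]\cap\mathcal{AP}\supseteq row[i+1]\cap\mathcal{AP}$ for all $i<n-1$; it is initialized if $\mathcal{R}eq_D(row[0])=\emptyset$. Every row has a maximal factorization $A_0^{m_0}\cdots A_k^{m_k}$ ($A^m$ = $m$ repetitions, $m_i>0$, $A_i\ne A_{i+1}$). $rank(A)=|\mathrm{REQ}_\varphi|-|\mathcal{R}eq_D(A)|$. Rows $A_0^{m_0}\cdots A_k^{m_k}$ and $\hat A_0^{\hat m_0}\cdots\hat A_{\hat k}^{\hat m_{\hat k}}$ (maximal factorizations) are equivalent ($\sim$) iff $k=\hat k$ and for each $i$, $A_i=\hat A_i$ and either $m_i=\hat m_i$ or both $m_i,\hat m_i>rank(A_i)$. A row is minimal if $m_i\in[1,rank(A_i)+1]$ for all $i$. For a row $row$ of length $n$ and atom $A$, $succ_\varphi(row,A)=B_0\cdots B_n$ with $B_0=A$ and $row[i]B_i\Rightarrow B_{i+1}$ (the unique such atom) for $i<n$; $succ^{min}_\varphi(row,A)$ is the unique minimal row $\sim$-equivalent to $succ_\varphi(row,A)$. $G^{min}_\varphi$ has as vertices the initialized minimal $\varphi$-rows and an edge $row\to row'$ iff $row'=succ^{min}_\varphi(row,row'[0])$.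 Compass structures: for a finite linear order $\mathbb{S}=(S,<)$ let $\mathbb{P}_\mathbb{S}=\{(x,y):x,y\in S,x\le y\}$; a compass $\varphi$-structure is $\mathcal{G}=(\mathbb{P}_\mathbb{S},\mathcal{L})$ with $\mathcal{L}$ mapping points to $\varphi$-atoms such that $\mathcal{L}(x,y)\,D_\varphi\,\mathcal{L}(x',y')$ whenever $(x',y')\sqsubset(x,y)$, i.e., $x\le x'$, $y'\le y$, $(x',y')\ne(x,y)$. It is fulfilling if for every point $(x,y)$ and $\psi\in\mathcal{R}eq_D(\mathcal{L}(x,y))$ there is $(x',y')\sqsubset(x,y)$ with $\psi\in\mathcal{L}(x',y')$; homogeneous if for every point $(x,y)$ and $p\in\mathcal{AP}$, $p\in\mathcal{L}(x,y)$ iff $p\in\mathcal{L}(x',x')$ for all $x'\in[x,y]$; it features $\psi$ if $\psi\in\mathcal{L}(x,y)$ for some point. -}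

module Defs where

open import Data.Nat using (ℕ; zero; suc; _∸_; _<_; _≤_; _+_)
open import Data.Fin as Fin using (Fin)
open import Data.Bool using (Bool; true; false; T)
open import Data.Maybe using (Maybe; just; nothing; maybe; is-just)
import Data.Maybe as Maybe
open import Data.List using (List; []; _∷_; length; map; _++_; deduplicate; allFin; filterᵇ; lookup; head)
open import Data.List.Relation.Unary.All using (All)
open import Data.List.Relation.Unary.Linked using (Linked)
open import Data.List.Relation.Binary.Pointwise using (Pointwise)
open import Data.Vec as Vec using (Vec)
import Data.Vec.Properties as VecP
import Data.Bool.Properties as BoolP
import Data.Fin.Properties as FinP
open import Data.Product using (Σ; ∃; ∃-syntax; _×_; _,_)
open import Data.Sum using (_⊎_)
open import Data.Empty using (⊥)
open import Relation.Nullary using (¬_; Dec; yes; no)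
open import Relation.Binary.PropositionalEquality using (_≡_; _≢_; refl; cong; cong₂)
open import Relation.Binary.Construct.Closure.ReflexiveTransitive using (Star)
open import Function.Bundles using (_⇔_)

infixr 6 _∨_
data Formula (n : ℕ) : Set where
  var  : Fin n → Formula n
  ~_   : Formula n → Formula n
  _∨_  : Formula n → Formula n → Formula n
  ⟨D⟩_ : Formula n → Formula n

[D]_ : ∀ {n} → Formula n → Formula n
[D] ψ = ~ (⟨D⟩ (~ ψ))

module _ {n : ℕ} where

  _≟F_ : (a b : Formula n) → Dec (a ≡ b)
  var p ≟F var q with p Fin.≟ q
  ... | yes refl = yes refl
  ... | no ne = no λ { refl → ne refl }
  var _ ≟F (~ _) = no λ ()
  var _ ≟F (_ ∨ _) = no λ ()
  var _ ≟F (⟨D⟩ _) = no λ ()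
  (~ _) ≟F var _ = no λ ()
  (~ a) ≟F (~ b) with a ≟F b
  ... | yes refl = yes refl
  ... | no ne = no λ { refl → ne refl }
  (~ _) ≟F (_ ∨ _) = no λ ()
  (~ _) ≟F (⟨D⟩ _) = no λ ()
  (_ ∨ _) ≟F var _ = no λ ()
  (_ ∨ _) ≟F (~ _) = no λ ()
  (a ∨ b) ≟F (c ∨ d) with a ≟F c | b ≟F d
  ... | yes refl | yes refl = yes refl
  ... | no ne | _ = no λ { refl → ne refl }
  ... | yes _ | no ne = no λ { refl → ne refl }
  (_ ∨ _) ≟F (⟨D⟩ _) = no λ ()
  (⟨D⟩ _) ≟F var _ = no λ ()
  (⟨D⟩ _) ≟F (~ _) = no λ ()
  (⟨D⟩ _) ≟F (_ ∨ _) = no λ ()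
  (⟨D⟩ a) ≟F (⟨D⟩ b) with a ≟F b
  ... | yes refl = yes refl
  ... | no ne = no λ { refl → ne refl }

  neg : Formula n → Formula n
  neg (~ χ) = χ
  neg χ = ~ χ

  -- Normal form: representative of a formula modulo ¬¬ψ = ψ.
  -- (This also realises ¬⟨D⟩ψ = [D]¬ψ = ¬⟨D⟩¬¬ψ.)
  nf : Formula n → Formula n
  nf (var p) = var p
  nf (~ ψ) = neg (nf ψ)
  nf (a ∨ b) = nf a ∨ nf b
  nf (⟨D⟩ ψ) = ⟨D⟩ nf ψ

  subs : Formula n → List (Formula n)
  subs (var p) = var p ∷ []
  subs (~ ψ) = (~ ψ) ∷ subs ψ
  subs (a ∨ b) = (a ∨ b) ∷ subs a ++ subs b
  subs (⟨D⟩ ψ) = (⟨D⟩ ψ) ∷ subs ψ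

  index? : (x : Formula n) (xs : List (Formula n)) → Maybe (Fin (length xs))
  index? x [] = nothing
  index? x (y ∷ ys) with x ≟F y
  ... | yes _ = just Fin.zero
  ... | no _ = Maybe.map Fin.suc (index? x ys)

  count : ∀ {k} → (Fin k → Bool) → ℕ
  count {k} f = length (filterᵇ f (allFin k))

module _ {n : ℕ} (φ : Formula n) where

  CL : List (Formula n)
  CL = deduplicate _≟F_ (map nf (subs φ) ++ map (λ ψ → neg (nf ψ)) (subs φ))

  -- A φ-atom candidate: a subset of CL(φ), as a characteristic vector
  Atom : Set
  Atom = Vec Bool (length CL)

  _≟A_ : (A B : Atom) → Dec (A ≡ B)
  _≟A_ = VecP.≡-dec BoolP._≟_

  memb : Atom → Formula n → Bool
  memb A ψ = maybe (Vec.lookup A) false (index? (nf ψ) CL)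

  _∈A_ : Formula n → Atom → Set
  ψ ∈A A = T (memb A ψ)

  _∈CL : Formula n → Set
  ψ ∈CL = T (is-just (index? (nf ψ) CL))

  IsAtom : Atom → Set
  IsAtom A =
      (∀ ψ → ψ ∈CL → (ψ ∈A A ⇔ (¬ ((~ ψ) ∈A A))))
    × (∀ ψ₁ ψ₂ → (ψ₁ ∨ ψ₂) ∈CL → ((ψ₁ ∨ ψ₂) ∈A A ⇔ (ψ₁ ∈A A ⊎ ψ₂ ∈A A)))

  InREQ : Formula n → Set
  InREQ ψ = (⟨D⟩ ψ) ∈CL

  _D_ : Atom → Atom → Set
  A D A' = ∀ ψ → ([D] ψ) ∈A A → (ψ ∈A A') × (([D] ψ) ∈A A')

  _⊇AP_ : Atom → Atom → Set
  A ⊇AP A' = ∀ p → var p ∈A A' → var p ∈A A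

  Gen : Atom → Atom → Atom → Set
  Gen A₁ A₂ A₃ =
      IsAtom A₃
    × (∀ p → var p ∈A A₃ ⇔ (var p ∈A A₁ × var p ∈A A₂))
    × (∀ ψ → (⟨D⟩ ψ) ∈A A₃ ⇔
         ((⟨D⟩ ψ) ∈A A₁ ⊎ (⟨D⟩ ψ) ∈A A₂ ⊎ (ψ ∈A A₁ × InREQ ψ) ⊎ (ψ ∈A A₂ × InREQ ψ)))

  -- rank(A) = |REQ_φ| - |Req_D(A)|   (elements of CL(φ) are pairwise distinct)
  rank : Atom → ℕ
  rank A = count {length CL} (λ i → is-just (index? (nf (⟨D⟩ lookup CL i)) CL))
         ∸ count {length CL} (λ i → memb A (⟨D⟩ lookup CL i))

  -- Rows: row[0] is the head of the list
  RowStep : Atom → Atom → Set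
  RowStep A B = (B D A) × (A ⊇AP B)

  IsRow : List Atom → Set
  IsRow row = (0 < length row) × All IsAtom row × Linked RowStep row

  Initialized : List Atom → Set
  Initialized [] = ⊥
  Initialized (A ∷ _) = ∀ ψ → ¬ ((⟨D⟩ ψ) ∈A A)

  -- maximal factorization A₀^m₀ ⋯ A_k^m_k (run-length encoding)
  factor : List Atom → List (Atom × ℕ)
  factor [] = []
  factor (A ∷ row) with factor row
  ... | [] = (A , 1) ∷ []
  ... | (B , k) ∷ bs with A ≟A B
  ...   | yes _ = (B , suc k) ∷ bs
  ...   | no _ = (A , 1) ∷ (B , k) ∷ bs

  BlockEq : Atom × ℕ → Atom × ℕ → Set
  BlockEq (A , m) (A' , m') = (A ≡ A') × ((m ≡ m') ⊎ ((rank A < m) × (rank A' < m')))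

  _∼_ : List Atom → List Atom → Set
  row ∼ row' = Pointwise BlockEq (factor row) (factor row')

  Minimal : List Atom → Set
  Minimal row = All (λ { (A , m) → (1 ≤ m) × (m ≤ rank A + 1) }) (factor row)

  data Succ : List Atom → Atom → List Atom → Set where
    done : ∀ {A} → Succ [] A (A ∷ [])
    step : ∀ {R row A B S} → Gen R A B → Succ row B S → Succ (R ∷ row) A (A ∷ S)

  Vertex : List Atom → Set
  Vertex row = IsRow row × Initialized row × Minimal row

  -- edges of G^min_φ : row' = succ^min_φ(row, row'[0]), i.e. row' is the
  -- (unique) minimal row equivalent to succ_φ(row, row'[0])
  Edge : List Atom → List Atom → Set
  Edge row [] = Vertex row × Vertex []
  Edge row (A ∷ row') = Vertex row × Vertex (A ∷ row')
    × Σ (List Atom) (λ S → Succ row A S × ((A ∷ row') ∼ S))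

  Reachable : List Atom → List Atom → Set
  Reachable = Star Edge

  Labelling : ℕ → Set
  Labelling N = Fin N → Fin N → Atom

  _⊏_ : ∀ {N} → Fin N × Fin N → Fin N × Fin N → Set
  (x' , y') ⊏ (x , y) = (x Fin.≤ x') × (y' Fin.≤ y) × ¬ ((x' ≡ x) × (y' ≡ y))

  IsCompass : ∀ {N} → Labelling N → Set
  IsCompass {N} L =
      (∀ (x y : Fin N) → x Fin.≤ y → IsAtom (L x y))
    × (∀ (x y x' y' : Fin N) → x Fin.≤ y → x' Fin.≤ y' → (x' , y') ⊏ (x , y)
         → L x y D L x' y')

  Fulfilling : ∀ {N} → Labelling N → Set
  Fulfilling {N} L = ∀ (x y : Fin N) → x Fin.≤ y → ∀ ψ → (⟨D⟩ ψ) ∈A L x y →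
    ∃[ x' ] ∃[ y' ] ((x' Fin.≤ y') × ((x' , y') ⊏ (x , y)) × (ψ ∈A L x' y'))

  Homogeneous : ∀ {N} → Labelling N → Set
  Homogeneous {N} L = ∀ (x y : Fin N) → x Fin.≤ y → ∀ (p : Fin n) →
    (var p ∈A L x y ⇔ (∀ (x' : Fin N) → x Fin.≤ x' → x' Fin.≤ y → var p ∈A L x' x'))

  Features : ∀ {N} → Labelling N → Formula n → Set
  Features {N} L ψ = ∃[ x ] ∃[ y ] ((x Fin.≤ y) × (ψ ∈A L x y))

-- A compass structure on [0, M] is determined column by column. Read from the
-- point (y, y) down to (0, y), column y is an initialized φ-row, and column y + 1
-- is the successor of column y that starts with the atom at (y + 1, y + 1), because
-- generation A₁ A₂ ⇒ A₃ expresses exactly the requirements on an interval whose two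
-- maximal subintervals are labelled A₁ and A₂. Conversely, rows generated in this way
-- from a single initialized atom label a homogeneous fulfilling compass structure.
--
-- G^min_φ replaces rows by their ∼-classes, which is sound because successors
-- respect ∼: along a block A^k with k > rank A the generated atoms only gain requests,
-- and an atom whose rank does not drop stays the same, so generation reaches some Z
-- with A Z ⇒ Z and ends in more than rank Z copies of Z. Inserting or deleting one A
-- in the block thus inserts or deletes one Z in the successor.

module Submission where

open import Defs
open import Level using (Level)
open import Data.Nat using (ℕ; zero; suc; _+_; _∸_; _≤_; _<_; _⊓_; _≤?_; z≤n; s≤s)
import Data.Nat as ℕ
open import Data.Nat.Properties
  using (+-cancelʳ-<; +-comm; +-identityʳ; +-monoʳ-<; +-monoˡ-≤; +-suc; +-∸-assoc; <-≤-trans; <⇒≢; <⇒≤;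
         m+[n∸m]≡n; m<n⇒0<n∸m; m<n⇒m<1+n; m∸[m∸n]≡n; m∸n≤m; m≤m+n; m≤n+m; m≤n⇒m<n∨m≡n; m≤n⇒m≤1+n;
         m≤n⇒m⊓n≡m; m≥n⇒m⊓n≡n; m⊓n≤n; ⊓-glb; n<1+n; n<1⇒n≡0; n∸n≡0; n≤1+n; ∸-monoʳ-<; ∸-monoʳ-≤;
         ≤-<-trans; ≤-antisym; ≤-pred; ≤-refl; ≤-trans; ≤∧≢⇒<; ≰⇒>; _<?_)
open import Data.Fin as Fin using (Fin; toℕ; fromℕ<)
open import Data.Fin.Properties using (toℕ-injective; toℕ<n; toℕ-fromℕ<)
open import Data.Bool using (Bool; true; false; T)
open import Data.Bool.Properties using (T-≡; ⇔→≡)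
open import Data.Unit using (⊤; tt)
open import Data.Empty using (⊥; ⊥-elim)
open import Data.Maybe using (just; maybe; is-just)
import Data.Vec as Vec
open import Data.Vec.Properties using (tabulate∘lookup; tabulate-cong)
open import Data.List using (List; []; _∷_; _++_; _∷ʳ_; [_]; map; replicate; length; lookup; filterᵇ; allFin)
open import Data.List.Properties using (++-assoc)
open import Data.List.Membership.Propositional using (_∈_; lose)
open import Data.List.Membership.Propositional.Properties
  using (∈-map⁺; ∈-map⁻; ∈-++⁺ˡ; ∈-++⁺ʳ; ∈-++⁻; deduplicate-∈⇔; ∈-lookup; ∈-allFin)
open import Data.List.Relation.Unary.Any using (Any; here; there)
import Data.List.Relation.Unary.Any as Any
open import Data.List.Relation.Unary.Any.Properties using (lookup-index)
open import Data.List.Relation.Unary.All using (All; []; _∷_)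
import Data.List.Relation.Unary.All as All
import Data.List.Relation.Unary.All.Properties as Allₚ
open import Data.List.Relation.Unary.AllPairs using (_∷_)
open import Data.List.Relation.Unary.Linked using (Linked; []; [-]; _∷_)
import Data.List.Relation.Unary.Linked as Linked
import Data.List.Relation.Unary.Linked.Properties as Linkedₚ
open import Data.List.Relation.Unary.Unique.Propositional using (Unique)
open import Data.List.Relation.Unary.Unique.DecPropositional.Properties using (deduplicate-!)
open import Data.List.Relation.Binary.Pointwise using (Pointwise; []; _∷_)
import Data.List.Relation.Binary.Pointwise as Pointwise
open import Data.Product using (Σ; ∃; ∃₂; ∃-syntax; _×_; _,_; proj₁; proj₂)
import Data.Product as Prod
open import Data.Product.Function.NonDependent.Propositional using (_×-⇔_)
open import Data.Sum using (_⊎_; inj₁; inj₂)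
import Data.Sum as Sum
open import Relation.Nullary using (¬_; Dec; yes; no; contradiction)
open import Relation.Binary.Structures using (IsEquivalence)
import Relation.Binary.Construct.On as On
open import Relation.Binary.Construct.Closure.ReflexiveTransitive using (Star; ε; _◅_; _◅◅_)
import Relation.Binary.Construct.Closure.ReflexiveTransitive as Star
open import Relation.Binary.Construct.Closure.Symmetric using (fwd; bwd)
open import Relation.Binary.Construct.Closure.Equivalence using (EqClosure)
import Relation.Binary.Construct.Closure.Equivalence as EqClosure
open import Relation.Binary.PropositionalEquality
  using (_≡_; _≢_; refl; cong; cong₂; sym; trans; subst; subst₂; module ≡-Reasoning)
open import Function.Base using (_∘_)
open import Function.Bundles using (_⇔_; mk⇔; Equivalence)
import Function.Properties.Equivalence as ⇔

open Equivalence using (to; from)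

module _ {a : Level} {X : Set a} where

  replicate-∷ : ∀ k (x : X) ys → replicate k x ++ x ∷ ys ≡ x ∷ replicate k x ++ ys
  replicate-∷ zero x ys = refl
  replicate-∷ (suc k) x ys = cong (x ∷_) (replicate-∷ k x ys)

  replicate-∷ʳ : ∀ k (x : X) → replicate k x ∷ʳ x ≡ replicate (suc k) x
  replicate-∷ʳ zero x = refl
  replicate-∷ʳ (suc k) x = cong (x ∷_) (replicate-∷ʳ k x)

  module _ {p : Level} {P : X → Set p} where

    Any-merge⇔ : ∀ xs x ys → Any P (xs ++ x ∷ x ∷ ys) ⇔ Any P (xs ++ x ∷ ys)
    Any-merge⇔ xs x ys = mk⇔ (merge xs) (split xs)
      where
      merge : ∀ xs → Any P (xs ++ x ∷ x ∷ ys) → Any P (xs ++ x ∷ ys)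
      merge [] (here px) = here px
      merge [] (there q) = q
      merge (_ ∷ xs) (here px) = here px
      merge (_ ∷ xs) (there q) = there (merge xs q)
      split : ∀ xs → Any P (xs ++ x ∷ ys) → Any P (xs ++ x ∷ x ∷ ys)
      split [] q = there q
      split (_ ∷ xs) (here px) = here px
      split (_ ∷ xs) (there q) = there (split xs q)

    All-merge : ∀ xs x ys → All P (xs ++ x ∷ x ∷ ys) → All P (xs ++ x ∷ ys)
    All-merge xs x ys ps with Allₚ.++⁻ xs ps
    ... | pxs , _ ∷ pys = Allₚ.++⁺ pxs pys

  Linked-merge : ∀ {r} {R : X → X → Set r} xs x ys → Linked R (xs ++ x ∷ x ∷ ys) → Linked R (xs ++ x ∷ ys)
  Linked-merge [] x ys (_ ∷ l) = l
  Linked-merge (_ ∷ []) x ys (r ∷ l) = r ∷ Linked-merge [] x ys l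
  Linked-merge (_ ∷ z ∷ xs) x ys (r ∷ l) = r ∷ Linked-merge (z ∷ xs) x ys l

  module _ (f g : X → Bool) (f⇒g : ∀ x → T (f x) → T (g x)) where

    filterᵇ-length-mono : ∀ xs → length (filterᵇ f xs) ≤ length (filterᵇ g xs)
    filterᵇ-length-mono [] = z≤n
    filterᵇ-length-mono (x ∷ xs) with f x | g x | f⇒g x
    ... | false | false | _ = filterᵇ-length-mono xs
    ... | false | true  | _ = m≤n⇒m≤1+n (filterᵇ-length-mono xs)
    ... | true  | false | h = ⊥-elim (h tt)
    ... | true  | true  | _ = s≤s (filterᵇ-length-mono xs)

    filterᵇ-length-strict : ∀ {x xs} → x ∈ xs → T (g x) → ¬ T (f x) →
                            length (filterᵇ f xs) < length (filterᵇ g xs)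
    filterᵇ-length-strict {xs = y ∷ xs} (here refl) gx ¬fx with f y | g y
    ... | true  | _     = ⊥-elim (¬fx tt)
    ... | false | false = ⊥-elim gx
    ... | false | true  = s≤s (filterᵇ-length-mono xs)
    filterᵇ-length-strict {xs = y ∷ xs} (there x∈) gx ¬fx
      with f y | g y | f⇒g y | filterᵇ-length-strict x∈ gx ¬fx
    ... | false | false | _ | ih = ih
    ... | false | true  | _ | ih = m≤n⇒m≤1+n ih
    ... | true  | false | h | _  = ⊥-elim (h tt)
    ... | true  | true  | _ | ih = s≤s ih

StrictlyInside : ℕ → ℕ → ℕ → ℕ → Set
StrictlyInside x y x′ y′ = x ≤ x′ × x′ ≤ y′ × y′ ≤ y × ¬ (x′ ≡ x × y′ ≡ y)

inside-or-equal : ∀ {x y x′ y′} → x ≤ x′ → x′ ≤ y′ → y′ ≤ y → (x′ ≡ x × y′ ≡ y) ⊎ StrictlyInside x y x′ y′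
inside-or-equal {x} {y} {x′} {y′} x≤x′ x′≤y′ y′≤y with x′ ℕ.≟ x | y′ ℕ.≟ y
... | yes refl | yes refl = inj₁ (refl , refl)
... | no x′≢x | _ = inj₂ (x≤x′ , x′≤y′ , y′≤y , x′≢x ∘ proj₁)
... | yes _ | no y′≢y = inj₂ (x≤x′ , x′≤y′ , y′≤y , y′≢y ∘ proj₂)

StrictlyInside-left : ∀ {x y} → x ≤ y → StrictlyInside x (suc y) x y
StrictlyInside-left {y = y} x≤y = ≤-refl , x≤y , n≤1+n y , λ (_ , y≡y+1) → <⇒≢ (n<1+n y) y≡y+1

StrictlyInside-right : ∀ {x y} → x < y → StrictlyInside x y (suc x) y
StrictlyInside-right {x} x<y = n≤1+n x , x<y , ≤-refl , λ (x+1≡x , _) → <⇒≢ (n<1+n x) (sym x+1≡x)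

StrictlyInside-widenʳ : ∀ {x y x′ y′} → StrictlyInside x y x′ y′ → StrictlyInside x (suc y) x′ y′
StrictlyInside-widenʳ (x≤x′ , x′≤y′ , y′≤y , _) =
  x≤x′ , x′≤y′ , m≤n⇒m≤1+n y′≤y , λ (_ , y′≡y+1) → <⇒≢ (s≤s y′≤y) y′≡y+1

StrictlyInside-widenˡ : ∀ {x y x′ y′} → StrictlyInside (suc x) y x′ y′ → StrictlyInside x y x′ y′
StrictlyInside-widenˡ {x} (x<x′ , x′≤y′ , y′≤y , _) =
  ≤-trans (n≤1+n x) x<x′ , x′≤y′ , y′≤y , λ (x′≡x , _) → <⇒≢ x<x′ (sym x′≡x)

∀-interval-split : ∀ {p} {P : ℕ → Set p} {x y} → x ≤ y →
                   (∀ z → x ≤ z → z ≤ suc y → P z) ⇔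
                   ((∀ z → x ≤ z → z ≤ y → P z) × (∀ z → suc x ≤ z → z ≤ suc y → P z))
∀-interval-split {P = P} {x} {y} x≤y = mk⇔
  (λ h → (λ z x≤z z≤y → h z x≤z (m≤n⇒m≤1+n z≤y)) , (λ z x<z z≤y+1 → h z (≤-trans (n≤1+n x) x<z) z≤y+1))
  join
  where
  join : (∀ z → x ≤ z → z ≤ y → P z) × (∀ z → suc x ≤ z → z ≤ suc y → P z) → ∀ z → x ≤ z → z ≤ suc y → P z
  join (left , right) z x≤z z≤y+1 with z ℕ.≤? y
  ... | yes z≤y = left z x≤z z≤y
  ... | no z≰y = right z (≤-trans (s≤s x≤y) (≰⇒> z≰y)) z≤y+1

-- Saturates at M; only arguments ≤ M are ever used.
clamp : ∀ M → ℕ → Fin (suc M)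
clamp M x = fromℕ< (s≤s (m⊓n≤n x M))

toℕ-clamp : ∀ {M x} → x ≤ M → toℕ (clamp M x) ≡ x
toℕ-clamp {M} {x} x≤M = trans (toℕ-fromℕ< (s≤s (m⊓n≤n x M))) (m≤n⇒m⊓n≡m x≤M)

toℕ≤pred : ∀ {M} (i : Fin (suc M)) → toℕ i ≤ M
toℕ≤pred i = ≤-pred (toℕ<n i)

clamp-toℕ : ∀ {M} (i : Fin (suc M)) → clamp M (toℕ i) ≡ i
clamp-toℕ i = toℕ-injective (toℕ-clamp (toℕ≤pred i))

module _ {n : ℕ} where

  NoDoubleNeg : Formula n → Set
  NoDoubleNeg (~ (~ _)) = ⊥
  NoDoubleNeg _ = ⊤

  NotNeg : Formula n → Set
  NotNeg (~ _) = ⊥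
  NotNeg _ = ⊤

  nf-noDoubleNeg : (ψ : Formula n) → NoDoubleNeg (nf ψ)
  nf-noDoubleNeg (var p) = tt
  nf-noDoubleNeg (_ ∨ _) = tt
  nf-noDoubleNeg (⟨D⟩ _) = tt
  nf-noDoubleNeg (~ ψ) with nf ψ | nf-noDoubleNeg ψ
  ... | var _         | _ = tt
  ... | ~ var _       | _ = tt
  ... | ~ (_ ∨ _)     | _ = tt
  ... | ~ (⟨D⟩ _)     | _ = tt
  ... | _ ∨ _         | _ = tt
  ... | ⟨D⟩ _         | _ = tt

  neg-involutive : ∀ {χ : Formula n} → NoDoubleNeg χ → neg (neg χ) ≡ χ
  neg-involutive {var _} _ = refl
  neg-involutive {~ var _} _ = refl
  neg-involutive {~ (_ ∨ _)} _ = refl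
  neg-involutive {~ (⟨D⟩ _)} _ = refl
  neg-involutive {_ ∨ _} _ = refl
  neg-involutive {⟨D⟩ _} _ = refl

  neg-neg-nf : (ψ : Formula n) → neg (neg (nf ψ)) ≡ nf ψ
  neg-neg-nf ψ = neg-involutive (nf-noDoubleNeg ψ)

  neg≡⇒≡~ : ∀ (χ : Formula n) {ρ} → NotNeg ρ → neg χ ≡ ρ → χ ≡ ~ ρ
  neg≡⇒≡~ (~ χ) _ refl = refl
  neg≡⇒≡~ (var _) () refl
  neg≡⇒≡~ (_ ∨ _) () refl
  neg≡⇒≡~ (⟨D⟩ _) () refl

  nf-neg : (χ : Formula n) → nf (neg χ) ≡ neg (nf χ)
  nf-neg (var _) = refl
  nf-neg (~ χ) = sym (neg-neg-nf χ)
  nf-neg (_ ∨ _) = refl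
  nf-neg (⟨D⟩ _) = refl

  nf-idempotent : (ψ : Formula n) → nf (nf ψ) ≡ nf ψ
  nf-idempotent (var _) = refl
  nf-idempotent (~ ψ) = trans (nf-neg (nf ψ)) (cong neg (nf-idempotent ψ))
  nf-idempotent (ψ₁ ∨ ψ₂) = cong₂ _∨_ (nf-idempotent ψ₁) (nf-idempotent ψ₂)
  nf-idempotent (⟨D⟩ ψ) = cong ⟨D⟩_ (nf-idempotent ψ)

  subs-refl : (ψ : Formula n) → ψ ∈ subs ψ
  subs-refl (var _) = here refl
  subs-refl (~ _) = here refl
  subs-refl (_ ∨ _) = here refl
  subs-refl (⟨D⟩ _) = here refl

  subs-trans : ∀ (ψ : Formula n) {χ ρ} → χ ∈ subs ψ → ρ ∈ subs χ → ρ ∈ subs ψ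
  subs-trans (var _) (here refl) r = r
  subs-trans (~ _) (here refl) r = r
  subs-trans (~ ψ) (there q) r = there (subs-trans ψ q r)
  subs-trans (_ ∨ _) (here refl) r = r
  subs-trans (ψ₁ ∨ ψ₂) (there q) r with ∈-++⁻ (subs ψ₁) q
  ... | inj₁ q₁ = there (∈-++⁺ˡ (subs-trans ψ₁ q₁ r))
  ... | inj₂ q₂ = there (∈-++⁺ʳ (subs ψ₁) (subs-trans ψ₂ q₂ r))
  subs-trans (⟨D⟩ _) (here refl) r = r
  subs-trans (⟨D⟩ ψ) (there q) r = there (subs-trans ψ q r)

  SubNf : Formula n → Formula n → Set
  SubNf ψ χ = ∃ λ ρ → ρ ∈ subs ψ × nf ρ ≡ χ

  SubNf-~~ : ∀ (ψ : Formula n) {χ} → SubNf ψ χ → SubNf (~ (~ ψ)) χ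
  SubNf-~~ ψ (ρ , r , eq) = ρ , there (there r) , eq

  nf≡⟨D⟩⇒SubNf : ∀ (ψ : Formula n) {χ} → nf ψ ≡ ⟨D⟩ χ → SubNf ψ χ
  nf≡⟨D⟩⇒SubNf (⟨D⟩ ψ) refl = ψ , there (subs-refl ψ) , refl
  nf≡⟨D⟩⇒SubNf (~ (~ ψ)) eq = SubNf-~~ ψ (nf≡⟨D⟩⇒SubNf ψ (trans (sym (neg-neg-nf ψ)) eq))
  nf≡⟨D⟩⇒SubNf (var _) ()
  nf≡⟨D⟩⇒SubNf (~ var _) ()
  nf≡⟨D⟩⇒SubNf (~ (_ ∨ _)) ()
  nf≡⟨D⟩⇒SubNf (~ (⟨D⟩ _)) ()
  nf≡⟨D⟩⇒SubNf (_ ∨ _) ()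

  nf≡∨⇒SubNf : ∀ (ψ : Formula n) {χ₁ χ₂} → nf ψ ≡ χ₁ ∨ χ₂ → SubNf ψ χ₁ × SubNf ψ χ₂
  nf≡∨⇒SubNf (ψ₁ ∨ ψ₂) refl =
    (ψ₁ , there (∈-++⁺ˡ (subs-refl ψ₁)) , refl) , (ψ₂ , there (∈-++⁺ʳ (subs ψ₁) (subs-refl ψ₂)) , refl)
  nf≡∨⇒SubNf (~ (~ ψ)) eq with nf≡∨⇒SubNf ψ (trans (sym (neg-neg-nf ψ)) eq)
  ... | s₁ , s₂ = SubNf-~~ ψ s₁ , SubNf-~~ ψ s₂
  nf≡∨⇒SubNf (var _) ()
  nf≡∨⇒SubNf (~ var _) ()
  nf≡∨⇒SubNf (~ (_ ∨ _)) ()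
  nf≡∨⇒SubNf (~ (⟨D⟩ _)) ()
  nf≡∨⇒SubNf (⟨D⟩ _) ()

  nf≡~⇒SubNf : ∀ (ψ : Formula n) {χ} → nf ψ ≡ ~ χ → SubNf ψ χ
  nf≡~⇒SubNf (~ var p) refl = var p , there (here refl) , refl
  nf≡~⇒SubNf (~ (ψ₁ ∨ ψ₂)) refl = ψ₁ ∨ ψ₂ , there (subs-refl (ψ₁ ∨ ψ₂)) , refl
  nf≡~⇒SubNf (~ (⟨D⟩ ψ)) refl = ⟨D⟩ ψ , there (subs-refl (⟨D⟩ ψ)) , refl
  nf≡~⇒SubNf (~ (~ ψ)) eq = SubNf-~~ ψ (nf≡~⇒SubNf ψ (trans (sym (neg-neg-nf ψ)) eq))
  nf≡~⇒SubNf (var _) ()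
  nf≡~⇒SubNf (_ ∨ _) ()
  nf≡~⇒SubNf (⟨D⟩ _) ()

  index?-sound : ∀ (χ : Formula n) xs {i} → index? χ xs ≡ just i → lookup xs i ≡ χ
  index?-sound χ (ρ ∷ xs) eq with χ ≟F ρ
  index?-sound χ (ρ ∷ xs) refl | yes χ≡ρ = sym χ≡ρ
  ... | no _ with index? χ xs in eq′
  index?-sound χ (ρ ∷ xs) refl | no _ | just j = index?-sound χ xs eq′

  index?-complete : ∀ {χ : Formula n} {xs} → χ ∈ xs → ∃ λ i → index? χ xs ≡ just i
  index?-complete {χ} {ρ ∷ xs} q with χ ≟F ρ
  ... | yes _ = Fin.zero , refl
  index?-complete (here χ≡ρ) | no χ≢ρ = ⊥-elim (χ≢ρ χ≡ρ)
  index?-complete (there q) | no _ with index?-complete q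
  ... | i , eq rewrite eq = Fin.suc i , refl

  index?-lookup : ∀ {xs : List (Formula n)} → Unique xs → ∀ i → index? (lookup xs i) xs ≡ just i
  index?-lookup {ρ ∷ xs} _ Fin.zero with ρ ≟F ρ
  ... | yes _ = refl
  ... | no ρ≢ρ = ⊥-elim (ρ≢ρ refl)
  index?-lookup {ρ ∷ xs} (ρ∉ ∷ u) (Fin.suc i) with lookup xs i ≟F ρ
  ... | yes eq = ⊥-elim (All.lookup ρ∉ (∈-lookup i) (sym eq))
  ... | no _ rewrite index?-lookup u i = refl

module _ {n : ℕ} (φ : Formula n) where

  private
    Row : Set
    Row = List (Atom φ)
    Block : Set
    Block = Atom φ × ℕ
    infix 4 _∈ₐ_ _Dφ_
    _∈ₐ_ : Formula n → Atom φ → Set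
    _∈ₐ_ = _∈A_ φ
    InCL : Formula n → Set
    InCL = _∈CL φ
    _Dφ_ : Atom φ → Atom φ → Set
    _Dφ_ = _D_ φ
    _≟ₐ_ : (A B : Atom φ) → Dec (A ≡ B)
    _≟ₐ_ = _≟A_ φ
    variable
      ψ χ χ₁ χ₂ : Formula n

  Closure : Formula n → Set
  Closure χ = ∃ λ ψ → ψ ∈ subs φ × (nf ψ ≡ χ ⊎ neg (nf ψ) ≡ χ)

  ∈CL⇒Closure : χ ∈ CL φ → Closure χ
  ∈CL⇒Closure q with ∈-++⁻ (map nf (subs φ)) (from (deduplicate-∈⇔ _≟F_) q)
  ... | inj₁ q′ with ∈-map⁻ nf q′
  ...   | ψ , r , eq = ψ , r , inj₁ (sym eq)
  ∈CL⇒Closure q | inj₂ q′ with ∈-map⁻ (neg ∘ nf) q′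
  ...   | ψ , r , eq = ψ , r , inj₂ (sym eq)

  Closure⇒∈CL : Closure χ → χ ∈ CL φ
  Closure⇒∈CL (ψ , r , inj₁ refl) =
    to (deduplicate-∈⇔ _≟F_) (∈-++⁺ˡ (∈-map⁺ nf r))
  Closure⇒∈CL (ψ , r , inj₂ refl) =
    to (deduplicate-∈⇔ _≟F_) (∈-++⁺ʳ (map nf (subs φ)) (∈-map⁺ (neg ∘ nf) r))

  Closure-neg : Closure χ → Closure (neg χ)
  Closure-neg (ψ , r , inj₁ eq) = ψ , r , inj₂ (cong neg eq)
  Closure-neg (ψ , r , inj₂ eq) = ψ , r , inj₁ (trans (sym (neg-neg-nf ψ)) (cong neg eq))

  SubNf⇒Closure : ψ ∈ subs φ → SubNf ψ χ → Closure χ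
  SubNf⇒Closure r (ρ , r′ , eq) = ρ , subs-trans φ r r′ , inj₁ eq

  Closure-⟨D⟩ : Closure (⟨D⟩ χ) → Closure χ
  Closure-⟨D⟩ (ψ , r , inj₁ eq) = SubNf⇒Closure r (nf≡⟨D⟩⇒SubNf ψ eq)
  Closure-⟨D⟩ (ψ , r , inj₂ eq) with nf≡~⇒SubNf ψ (neg≡⇒≡~ (nf ψ) tt eq)
  ... | ρ , r′ , eq′ = SubNf⇒Closure (subs-trans φ r r′) (nf≡⟨D⟩⇒SubNf ρ eq′)

  Closure-∨ : Closure (χ₁ ∨ χ₂) → Closure χ₁ × Closure χ₂
  Closure-∨ (ψ , r , inj₁ eq) = Prod.map (SubNf⇒Closure r) (SubNf⇒Closure r) (nf≡∨⇒SubNf ψ eq)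
  Closure-∨ (ψ , r , inj₂ eq) with nf≡~⇒SubNf ψ (neg≡⇒≡~ (nf ψ) tt eq)
  ... | ρ , r′ , eq′ =
    Prod.map (SubNf⇒Closure (subs-trans φ r r′)) (SubNf⇒Closure (subs-trans φ r r′)) (nf≡∨⇒SubNf ρ eq′)

  Closure⇒nf≡ : Closure χ → nf χ ≡ χ
  Closure⇒nf≡ (ψ , _ , inj₁ refl) = nf-idempotent ψ
  Closure⇒nf≡ (ψ , _ , inj₂ refl) = trans (nf-neg (nf ψ)) (cong neg (nf-idempotent ψ))

  ∈CL⇒ : ∀ ψ → InCL ψ → nf ψ ∈ CL φ
  ∈CL⇒ ψ t with index? (nf ψ) (CL φ) in eq
  ... | just i = subst (_∈ CL φ) (index?-sound (nf ψ) (CL φ) eq) (∈-lookup i)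

  ⇒∈CL : ∀ ψ → nf ψ ∈ CL φ → InCL ψ
  ⇒∈CL ψ q with index?-complete q
  ... | i , eq rewrite eq = tt

  ∈CL-lookup : ∀ i → InCL (lookup (CL φ) i)
  ∈CL-lookup i = ⇒∈CL (lookup (CL φ) i)
    (subst (_∈ CL φ) (sym (Closure⇒nf≡ (∈CL⇒Closure (∈-lookup i)))) (∈-lookup i))

  ∈CL-~ : ∀ ψ → InCL (~ ψ) → InCL ψ
  ∈CL-~ ψ c = ⇒∈CL ψ
    (subst (_∈ CL φ) (neg-neg-nf ψ) (Closure⇒∈CL (Closure-neg (∈CL⇒Closure (∈CL⇒ (~ ψ) c)))))

  ∈CL-⟨D⟩ : ∀ ψ → InCL (⟨D⟩ ψ) → InCL ψ
  ∈CL-⟨D⟩ ψ c = ⇒∈CL ψ (Closure⇒∈CL (Closure-⟨D⟩ (∈CL⇒Closure (∈CL⇒ (⟨D⟩ ψ) c))))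

  ∈CL-∨ˡ : ∀ ψ₁ ψ₂ → InCL (ψ₁ ∨ ψ₂) → InCL ψ₁
  ∈CL-∨ˡ ψ₁ ψ₂ c = ⇒∈CL ψ₁ (Closure⇒∈CL (proj₁ (Closure-∨ (∈CL⇒Closure (∈CL⇒ (ψ₁ ∨ ψ₂) c)))))

  ∈CL-∨ʳ : ∀ ψ₁ ψ₂ → InCL (ψ₁ ∨ ψ₂) → InCL ψ₂
  ∈CL-∨ʳ ψ₁ ψ₂ c = ⇒∈CL ψ₂ (Closure⇒∈CL (proj₂ (Closure-∨ (∈CL⇒Closure (∈CL⇒ (ψ₁ ∨ ψ₂) c)))))

  ∈CL⇒lookup : ∀ ψ → InCL ψ → ∃ λ i → lookup (CL φ) i ≡ nf ψ
  ∈CL⇒lookup ψ c with index?-complete (∈CL⇒ ψ c)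
  ... | i , eq = i , index?-sound (nf ψ) (CL φ) eq

  ∈A⇒∈CL : ∀ {A} ψ → ψ ∈ₐ A → InCL ψ
  ∈A⇒∈CL ψ t with index? (nf ψ) (CL φ)
  ... | just _ = tt

  memb-nf : ∀ A ψ χ → nf ψ ≡ nf χ → memb φ A ψ ≡ memb φ A χ
  memb-nf A ψ χ eq = cong (λ ρ → maybe (Vec.lookup A) false (index? ρ (CL φ))) eq

  ∈A-nf : ∀ A ψ χ → nf ψ ≡ nf χ → ψ ∈ₐ A → χ ∈ₐ A
  ∈A-nf A ψ χ eq = subst T (memb-nf A ψ χ eq)

  memb-lookup : ∀ A i → memb φ A (lookup (CL φ) i) ≡ Vec.lookup A i
  memb-lookup A i = cong (maybe (Vec.lookup A) false)
    (trans (cong (λ ρ → index? ρ (CL φ)) (Closure⇒nf≡ (∈CL⇒Closure (∈-lookup i))))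
           (index?-lookup (deduplicate-! _≟F_ (map nf (subs φ) ++ map (λ ψ → neg (nf ψ)) (subs φ))) i))

  ∈A-ext : ∀ {A B} → (∀ ψ → InCL ψ → (ψ ∈ₐ A ⇔ ψ ∈ₐ B)) → A ≡ B
  ∈A-ext {A} {B} h = begin
    A                                 ≡⟨ tabulate∘lookup A ⟨
    Vec.tabulate (Vec.lookup A)       ≡⟨ tabulate-cong lookup≡ ⟩
    Vec.tabulate (Vec.lookup B)       ≡⟨ tabulate∘lookup B ⟩
    B                                 ∎
    where
    open ≡-Reasoning
    lookup≡ : ∀ i → Vec.lookup A i ≡ Vec.lookup B i
    lookup≡ i = begin
      Vec.lookup A i                  ≡⟨ memb-lookup A i ⟨
      memb φ A (lookup (CL φ) i)      ≡⟨ ⇔→≡ (⇔.trans (⇔.sym T-≡) (⇔.trans (h (lookup (CL φ) i) (∈CL-lookup i)) T-≡)) ⟩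
      memb φ B (lookup (CL φ) i)      ≡⟨ memb-lookup B i ⟩
      Vec.lookup B i                  ∎

  _∈ₐ?_ : ∀ ψ A → Dec (ψ ∈ₐ A)
  ψ ∈ₐ? A with memb φ A ψ
  ... | true  = yes tt
  ... | false = no λ ()

  module _ (A : Atom φ) (atom : IsAtom φ A) (ψ : Formula n) (c : InCL ψ) where

    atom-∈⇒~∉ : ψ ∈ₐ A → ¬ (~ ψ) ∈ₐ A
    atom-∈⇒~∉ = to (proj₁ atom ψ c)

    atom-~∉⇒∈ : ¬ (~ ψ) ∈ₐ A → ψ ∈ₐ A
    atom-~∉⇒∈ = from (proj₁ atom ψ c)

    atom-∉⇒~∈ : ¬ ψ ∈ₐ A → (~ ψ) ∈ₐ A
    atom-∉⇒~∈ ψ∉ with (~ ψ) ∈ₐ? A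
    ... | yes ~ψ∈ = ~ψ∈
    ... | no ~ψ∉ = contradiction (atom-~∉⇒∈ ~ψ∉) ψ∉

  atom-ext : ∀ {A B} → IsAtom φ A → IsAtom φ B →
             (∀ p → var p ∈ₐ A ⇔ var p ∈ₐ B) → (∀ ψ → (⟨D⟩ ψ) ∈ₐ A ⇔ (⟨D⟩ ψ) ∈ₐ B) → A ≡ B
  atom-ext {A} {B} atomA atomB var⇔ ⟨D⟩⇔ = ∈A-ext agree
    where
    agree : ∀ ψ → InCL ψ → ψ ∈ₐ A ⇔ ψ ∈ₐ B
    agree (var p) _ = var⇔ p
    agree (⟨D⟩ ψ) _ = ⟨D⟩⇔ ψ
    agree (~ ψ) c = mk⇔
      (λ ~ψ∈A → atom-∉⇒~∈ B atomB ψ c′ λ ψ∈B → atom-∈⇒~∉ A atomA ψ c′ (from ψ⇔ ψ∈B) ~ψ∈A)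
      (λ ~ψ∈B → atom-∉⇒~∈ A atomA ψ c′ λ ψ∈A → atom-∈⇒~∉ B atomB ψ c′ (to ψ⇔ ψ∈A) ~ψ∈B)
      where
      c′ : InCL ψ
      c′ = ∈CL-~ ψ c
      ψ⇔ : ψ ∈ₐ A ⇔ ψ ∈ₐ B
      ψ⇔ = agree ψ c′
    agree (ψ₁ ∨ ψ₂) c = mk⇔
      (λ h → from (proj₂ atomB ψ₁ ψ₂ c) (Sum.map (to ψ₁⇔) (to ψ₂⇔) (to (proj₂ atomA ψ₁ ψ₂ c) h)))
      (λ h → from (proj₂ atomA ψ₁ ψ₂ c) (Sum.map (from ψ₁⇔) (from ψ₂⇔) (to (proj₂ atomB ψ₁ ψ₂ c) h)))
      where
      ψ₁⇔ : ψ₁ ∈ₐ A ⇔ ψ₁ ∈ₐ B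
      ψ₁⇔ = agree ψ₁ (∈CL-∨ˡ ψ₁ ψ₂ c)
      ψ₂⇔ : ψ₂ ∈ₐ A ⇔ ψ₂ ∈ₐ B
      ψ₂⇔ = agree ψ₂ (∈CL-∨ʳ ψ₁ ψ₂ c)

  Gen-functional : ∀ {A₁ A₂ B C} → Gen φ A₁ A₂ B → Gen φ A₁ A₂ C → B ≡ C
  Gen-functional (atom₃ , var₃ , ⟨D⟩₃) (atomB , varB , ⟨D⟩B) =
    atom-ext atom₃ atomB
      (λ p → mk⇔ (from (varB p) ∘ to (var₃ p)) (from (var₃ p) ∘ to (varB p)))
      (λ ψ → mk⇔ (from (⟨D⟩B ψ) ∘ to (⟨D⟩₃ ψ)) (from (⟨D⟩₃ ψ) ∘ to (⟨D⟩B ψ)))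

  [D]~⇔~⟨D⟩ : ∀ A ψ → ([D] (~ ψ)) ∈ₐ A ⇔ (~ (⟨D⟩ ψ)) ∈ₐ A
  [D]~⇔~⟨D⟩ A ψ = mk⇔ (∈A-nf A ([D] (~ ψ)) (~ (⟨D⟩ ψ)) nf≡) (∈A-nf A (~ (⟨D⟩ ψ)) ([D] (~ ψ)) (sym nf≡))
    where
    nf≡ : nf ([D] (~ ψ)) ≡ nf (~ (⟨D⟩ ψ))
    nf≡ = cong (λ χ → ~ (⟨D⟩ χ)) (neg-neg-nf ψ)

  GeneratedRequest : Atom φ → Atom φ → Formula n → Set
  GeneratedRequest A₁ A₂ ψ = (⟨D⟩ ψ) ∈ₐ A₁ ⊎ (⟨D⟩ ψ) ∈ₐ A₂ ⊎ (ψ ∈ₐ A₁ × InREQ φ ψ) ⊎ (ψ ∈ₐ A₂ × InREQ φ ψ)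

  _⊆Req_ : Atom φ → Atom φ → Set
  A ⊆Req B = ∀ ψ → (⟨D⟩ ψ) ∈ₐ A → (⟨D⟩ ψ) ∈ₐ B

  _⊆Req∪Obs_ : Atom φ → Atom φ → Set
  A ⊆Req∪Obs B = A ⊆Req B × (∀ ψ → InREQ φ ψ → ψ ∈ₐ A → (⟨D⟩ ψ) ∈ₐ B)

  D⇔⊆Req∪Obs : ∀ {A B} → IsAtom φ A → IsAtom φ B → A Dφ B ⇔ B ⊆Req∪Obs A
  D⇔⊆Req∪Obs {A} {B} atomA atomB = mk⇔ D⇒ ⇒D
    where
    ¬⟨D⟩⇒[D]~ : ∀ ψ → InREQ φ ψ → ¬ (⟨D⟩ ψ) ∈ₐ A → ([D] (~ ψ)) ∈ₐ A
    ¬⟨D⟩⇒[D]~ ψ r ∉A = from ([D]~⇔~⟨D⟩ A ψ) (atom-∉⇒~∈ A atomA (⟨D⟩ ψ) r ∉A)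

    D⇒ : A Dφ B → B ⊆Req∪Obs A
    D⇒ d = req , obs
      where
      req : B ⊆Req A
      req ψ ∈B with (⟨D⟩ ψ) ∈ₐ? A
      ... | yes ∈A = ∈A
      ... | no ∉A = contradiction (to ([D]~⇔~⟨D⟩ B ψ) (proj₂ (d (~ ψ) (¬⟨D⟩⇒[D]~ ψ r ∉A))))
                      (atom-∈⇒~∉ B atomB (⟨D⟩ ψ) r ∈B)
        where
        r : InREQ φ ψ
        r = ∈A⇒∈CL {B} (⟨D⟩ ψ) ∈B
      obs : ∀ ψ → InREQ φ ψ → ψ ∈ₐ B → (⟨D⟩ ψ) ∈ₐ A
      obs ψ r ∈B with (⟨D⟩ ψ) ∈ₐ? A
      ... | yes ∈A = ∈A
      ... | no ∉A = contradiction (proj₁ (d (~ ψ) (¬⟨D⟩⇒[D]~ ψ r ∉A)))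
                      (atom-∈⇒~∉ B atomB ψ (∈A⇒∈CL {B} ψ ∈B) ∈B)

    ⇒D : B ⊆Req∪Obs A → A Dφ B
    ⇒D (req , obs) ψ [D]ψ∈A = ψ∈B , [D]ψ∈B
      where
      ◇¬ψ : Formula n
      ◇¬ψ = ⟨D⟩ (~ ψ)
      ◇¬ψ∈CL : InCL ◇¬ψ
      ◇¬ψ∈CL = ∈CL-~ ◇¬ψ (∈A⇒∈CL {A} ([D] ψ) [D]ψ∈A)
      ◇¬ψ∉A : ¬ ◇¬ψ ∈ₐ A
      ◇¬ψ∉A ◇¬ψ∈A = atom-∈⇒~∉ A atomA ◇¬ψ ◇¬ψ∈CL ◇¬ψ∈A [D]ψ∈A
      ψ∈B : ψ ∈ₐ B
      ψ∈B = atom-~∉⇒∈ B atomB ψ (∈CL-~ ψ (∈CL-⟨D⟩ (~ ψ) ◇¬ψ∈CL)) λ ~ψ∈B → ◇¬ψ∉A (obs (~ ψ) ◇¬ψ∈CL ~ψ∈B)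
      [D]ψ∈B : ([D] ψ) ∈ₐ B
      [D]ψ∈B = atom-∉⇒~∈ B atomB ◇¬ψ ◇¬ψ∈CL λ ◇¬ψ∈B → ◇¬ψ∉A (req (~ ψ) ◇¬ψ∈B)

  D-trans : ∀ {A B C} → A Dφ B → B Dφ C → A Dφ C
  D-trans A→B B→C ψ [D]ψ∈A = B→C ψ (proj₂ (A→B ψ [D]ψ∈A))

  Gen⇒⊆Req∪Obsˡ : ∀ {A₁ A₂ A₃} → Gen φ A₁ A₂ A₃ → A₁ ⊆Req∪Obs A₃
  Gen⇒⊆Req∪Obsˡ (_ , _ , ⟨D⟩⇔) =
    (λ ψ → from (⟨D⟩⇔ ψ) ∘ inj₁) , (λ ψ r ∈A₁ → from (⟨D⟩⇔ ψ) (inj₂ (inj₂ (inj₁ (∈A₁ , r)))))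

  Gen⇒⊆Req∪Obsʳ : ∀ {A₁ A₂ A₃} → Gen φ A₁ A₂ A₃ → A₂ ⊆Req∪Obs A₃
  Gen⇒⊆Req∪Obsʳ (_ , _ , ⟨D⟩⇔) =
    (λ ψ → from (⟨D⟩⇔ ψ) ∘ inj₂ ∘ inj₁) , (λ ψ r ∈A₂ → from (⟨D⟩⇔ ψ) (inj₂ (inj₂ (inj₂ (∈A₂ , r)))))

  Gen⇒Dˡ : ∀ {A₁ A₂ A₃} → IsAtom φ A₁ → Gen φ A₁ A₂ A₃ → A₃ Dφ A₁
  Gen⇒Dˡ {A₁} {A₂} {A₃} atom₁ g = from (D⇔⊆Req∪Obs {A₃} {A₁} (proj₁ g) atom₁) (Gen⇒⊆Req∪Obsˡ {A₁} {A₂} {A₃} g)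

  Gen⇒Dʳ : ∀ {A₁ A₂ A₃} → IsAtom φ A₂ → Gen φ A₁ A₂ A₃ → A₃ Dφ A₂
  Gen⇒Dʳ {A₁} {A₂} {A₃} atom₂ g = from (D⇔⊆Req∪Obs {A₃} {A₂} (proj₁ g) atom₂) (Gen⇒⊆Req∪Obsʳ {A₁} {A₂} {A₃} g)

  private
    Index : Set
    Index = Fin (length (CL φ))

    inREQ : Index → Bool
    inREQ i = is-just (index? (nf (⟨D⟩ lookup (CL φ) i)) (CL φ))

    requests : Atom φ → Index → Bool
    requests A i = memb φ A (⟨D⟩ lookup (CL φ) i)

    #_ : (Index → Bool) → ℕ
    # f = length (filterᵇ f (allFin (length (CL φ))))

    #requests≤#REQ : ∀ A → # requests A ≤ # inREQ
    #requests≤#REQ A = filterᵇ-length-mono (requests A) inREQ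
      (λ i → ∈A⇒∈CL {A} (⟨D⟩ lookup (CL φ) i)) (allFin (length (CL φ)))

    index-of-⟨D⟩ : ∀ ψ → InCL ψ → Σ Index λ i → nf (⟨D⟩ lookup (CL φ) i) ≡ nf (⟨D⟩ ψ)
    index-of-⟨D⟩ ψ c = Prod.map₂ (λ eq → cong ⟨D⟩_ (trans (cong nf eq) (nf-idempotent ψ))) (∈CL⇒lookup ψ c)

  rank-antitone : ∀ {A B} → A ⊆Req B → rank φ B ≤ rank φ A
  rank-antitone {A} {B} A⊆B = ∸-monoʳ-≤ (# inREQ)
    (filterᵇ-length-mono (requests A) (requests B) (λ i → A⊆B (lookup (CL φ) i)) (allFin (length (CL φ))))

  rank-strict : ∀ {A B} ψ → A ⊆Req B → (⟨D⟩ ψ) ∈ₐ B → ¬ (⟨D⟩ ψ) ∈ₐ A → rank φ B < rank φ A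
  rank-strict {A} {B} ψ A⊆B ∈B ∉A =
    let (i , eq) = index-of-⟨D⟩ ψ (∈CL-⟨D⟩ ψ (∈A⇒∈CL {B} (⟨D⟩ ψ) ∈B)) in
    ∸-monoʳ-< {# inREQ} {# requests B} {# requests A}
      (filterᵇ-length-strict (requests A) (requests B) (λ j → A⊆B (lookup (CL φ) j)) (∈-allFin i)
        (∈A-nf B (⟨D⟩ ψ) (⟨D⟩ lookup (CL φ) i) (sym eq) ∈B)
        (∉A ∘ ∈A-nf A (⟨D⟩ lookup (CL φ) i) (⟨D⟩ ψ) eq))
      (#requests≤#REQ B)

  rank≡0⇒requests-REQ : ∀ A ψ → rank φ A ≡ 0 → InREQ φ ψ → (⟨D⟩ ψ) ∈ₐ A
  rank≡0⇒requests-REQ A ψ rank≡0 r with (⟨D⟩ ψ) ∈ₐ? A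
  ... | yes ∈A = ∈A
  ... | no ∉A =
    let (i , eq) = index-of-⟨D⟩ ψ (∈CL-⟨D⟩ ψ r) in
    contradiction (subst (0 <_) rank≡0 (m<n⇒0<n∸m
      (filterᵇ-length-strict (requests A) inREQ (λ j → ∈A⇒∈CL {A} (⟨D⟩ lookup (CL φ) j)) (∈-allFin i)
        (subst (λ χ → T (is-just (index? χ (CL φ)))) (sym eq) r)
        (∉A ∘ ∈A-nf A (⟨D⟩ lookup (CL φ) i) (⟨D⟩ ψ) eq))))
      λ ()

  -- The equivalence ∼ of rows

  data Shorten : Row → Row → Set where
    shorten : ∀ P X k Q → rank φ X < k →
              Shorten (P ++ replicate k X ++ X ∷ Q) (P ++ replicate k X ++ Q)

  -- The equivalence closure of Shorten coincides with ∼ (≈⇒∼, ∼⇒≈) and is easier to induct on.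
  infix 4 _≈_
  _≈_ : Row → Row → Set
  _≈_ = EqClosure Shorten

  ≈-sym : ∀ {xs ys} → xs ≈ ys → ys ≈ xs
  ≈-sym = EqClosure.symmetric Shorten

  Shorten⇒merge : ∀ {xs ys} → Shorten xs ys →
                  ∃₂ λ P X → ∃ λ Q → xs ≡ P ++ X ∷ X ∷ Q × ys ≡ P ++ X ∷ Q
  Shorten⇒merge (shorten P X zero Q ())
  Shorten⇒merge (shorten P X (suc k) Q _) =
    P , X , replicate k X ++ Q , cong (λ R → P ++ X ∷ R) (replicate-∷ k X Q) , refl

  Shorten-++ˡ : ∀ R {xs ys} → Shorten xs ys → Shorten (R ++ xs) (R ++ ys)
  Shorten-++ˡ R (shorten P X k Q lt) =
    subst₂ Shorten (++-assoc R P _) (++-assoc R P _) (shorten (R ++ P) X k Q lt)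

  MergeClosed : (Row → Set) → Set
  MergeClosed Pr = ∀ P X Q → Pr (P ++ X ∷ X ∷ Q) → Pr (P ++ X ∷ Q)

  Star-Shorten-preserves : ∀ Pr → MergeClosed Pr → ∀ {xs ys} → Star Shorten xs ys → Pr xs → Pr ys
  Star-Shorten-preserves Pr closed ε pr = pr
  Star-Shorten-preserves Pr closed (s ◅ ss) pr with Shorten⇒merge s
  ... | P , X , Q , refl , refl = Star-Shorten-preserves Pr closed ss (closed P X Q pr)

  Any-resp-≈ : ∀ {p} {Pr : Atom φ → Set p} {xs ys} → xs ≈ ys → Any Pr xs → Any Pr ys
  Any-resp-≈ ε q = q
  Any-resp-≈ (fwd s ◅ ss) q with Shorten⇒merge s
  ... | P , X , Q , refl , refl = Any-resp-≈ ss (to (Any-merge⇔ P X Q) q)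
  Any-resp-≈ (bwd s ◅ ss) q with Shorten⇒merge s
  ... | P , X , Q , refl , refl = Any-resp-≈ ss (from (Any-merge⇔ P X Q) q)

  consBlock : Atom φ → List Block → List Block
  consBlock A [] = (A , 1) ∷ []
  consBlock A ((B , k) ∷ bs) with A ≟ₐ B
  ... | yes _ = (B , suc k) ∷ bs
  ... | no _  = (A , 1) ∷ (B , k) ∷ bs

  factor-∷ : ∀ A xs → factor φ (A ∷ xs) ≡ consBlock A (factor φ xs)
  factor-∷ A xs with factor φ xs
  ... | [] = refl
  ... | (B , k) ∷ bs with A ≟ₐ B
  ...   | yes _ = refl
  ...   | no _  = refl

  consBlock-same : ∀ A m bs → consBlock A ((A , m) ∷ bs) ≡ (A , suc m) ∷ bs
  consBlock-same A m bs with A ≟ₐ A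
  ... | yes _ = refl
  ... | no A≢A = ⊥-elim (A≢A refl)

  BlockEq-isEquivalence : IsEquivalence (BlockEq φ)
  BlockEq-isEquivalence = record { refl = refl , inj₁ refl ; sym = sym′ ; trans = trans′ }
    where
    sym′ : ∀ {b c} → BlockEq φ b c → BlockEq φ c b
    sym′ (refl , inj₁ m≡m′) = refl , inj₁ (sym m≡m′)
    sym′ (refl , inj₂ (lt , lt′)) = refl , inj₂ (lt′ , lt)
    trans′ : ∀ {b c d} → BlockEq φ b c → BlockEq φ c d → BlockEq φ b d
    trans′ (refl , inj₁ refl) q = q
    trans′ (refl , inj₂ lts) (refl , inj₁ refl) = refl , inj₂ lts
    trans′ (refl , inj₂ (lt , _)) (refl , inj₂ (_ , lt′)) = refl , inj₂ (lt , lt′)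

  ∼-isEquivalence : IsEquivalence (_∼_ φ)
  ∼-isEquivalence = On.isEquivalence (factor φ) (Pointwise.isEquivalence BlockEq-isEquivalence)

  consBlock-cong : ∀ A {bs cs} → Pointwise (BlockEq φ) bs cs →
                   Pointwise (BlockEq φ) (consBlock A bs) (consBlock A cs)
  consBlock-cong A [] = (refl , inj₁ refl) ∷ []
  consBlock-cong A (_∷_ {x = B , k} {y = .B , k′} (refl , k≈k′) bs≈cs) with A ≟ₐ B
  ... | yes _ = (refl , suc-cong k≈k′) ∷ bs≈cs
    where
    suc-cong : (k ≡ k′) ⊎ (rank φ B < k × rank φ B < k′) →
               (suc k ≡ suc k′) ⊎ (rank φ B < suc k × rank φ B < suc k′)
    suc-cong (inj₁ eq) = inj₁ (cong suc eq)
    suc-cong (inj₂ (lt , lt′)) = inj₂ (m<n⇒m<1+n lt , m<n⇒m<1+n lt′)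
  ... | no _ = (refl , inj₁ refl) ∷ (refl , k≈k′) ∷ bs≈cs

  ∼-++ˡ : ∀ P {xs ys} → _∼_ φ xs ys → _∼_ φ (P ++ xs) (P ++ ys)
  ∼-++ˡ [] xs∼ys = xs∼ys
  ∼-++ˡ (A ∷ P) {xs} {ys} xs∼ys =
    subst₂ (Pointwise (BlockEq φ)) (sym (factor-∷ A (P ++ xs))) (sym (factor-∷ A (P ++ ys)))
      (consBlock-cong A (∼-++ˡ P xs∼ys))

  factor-replicate : ∀ X k Q → ∃₂ λ m bs → factor φ (replicate (suc k) X ++ Q) ≡ (X , m) ∷ bs × suc k ≤ m
  factor-replicate X zero Q rewrite factor-∷ X Q with factor φ Q
  ... | [] = 1 , [] , refl , s≤s z≤n
  ... | (B , j) ∷ bs with X ≟ₐ B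
  ...   | yes refl = suc j , bs , refl , s≤s z≤n
  ...   | no _ = 1 , (B , j) ∷ bs , refl , s≤s z≤n
  factor-replicate X (suc k) Q with factor-replicate X k Q
  ... | m , bs , eq , le =
    suc m , bs , trans (factor-∷ X (replicate (suc k) X ++ Q)) (trans (cong (consBlock X) eq) (consBlock-same X m bs)) , s≤s le

  Shorten⇒∼ : ∀ {xs ys} → Shorten xs ys → _∼_ φ xs ys
  Shorten⇒∼ (shorten P X zero Q ())
  Shorten⇒∼ (shorten P X (suc k) Q lt) = ∼-++ˡ P run∼
    where
    run∼ : _∼_ φ (replicate (suc k) X ++ X ∷ Q) (replicate (suc k) X ++ Q)
    run∼ with factor-replicate X k Q
    ... | m , bs , eq , le = subst₂ (Pointwise (BlockEq φ)) (sym eq′) (sym eq)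
          ((refl , inj₂ (m<n⇒m<1+n (<-≤-trans lt le) , <-≤-trans lt le)) ∷ Pointwise.refl (refl , inj₁ refl))
      where
      eq′ : factor φ (replicate (suc k) X ++ X ∷ Q) ≡ (X , suc m) ∷ bs
      eq′ = trans (cong (factor φ) (replicate-∷ (suc k) X Q))
              (trans (factor-∷ X (replicate (suc k) X ++ Q)) (trans (cong (consBlock X) eq) (consBlock-same X m bs)))

  ≈⇒∼ : ∀ {xs ys} → xs ≈ ys → _∼_ φ xs ys
  ≈⇒∼ = EqClosure.fold ∼-isEquivalence Shorten⇒∼

  expand : List Block → Row
  expand [] = []
  expand ((A , m) ∷ bs) = replicate m A ++ expand bs

  expand-consBlock : ∀ A bs → expand (consBlock A bs) ≡ A ∷ expand bs
  expand-consBlock A [] = refl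
  expand-consBlock A ((B , k) ∷ bs) with A ≟ₐ B
  ... | yes refl = refl
  ... | no _ = refl

  expand-factor : ∀ xs → expand (factor φ xs) ≡ xs
  expand-factor [] = refl
  expand-factor (A ∷ xs) = begin
    expand (factor φ (A ∷ xs))       ≡⟨ cong expand (factor-∷ A xs) ⟩
    expand (consBlock A (factor φ xs)) ≡⟨ expand-consBlock A (factor φ xs) ⟩
    A ∷ expand (factor φ xs)         ≡⟨ cong (A ∷_) (expand-factor xs) ⟩
    A ∷ xs                           ∎
    where open ≡-Reasoning

  private
    Distinct : Block → Block → Set
    Distinct b c = proj₁ b ≢ proj₁ c

    Distinct-recount : ∀ {A m m′ bs} → Linked Distinct ((A , m) ∷ bs) → Linked Distinct ((A , m′) ∷ bs)
    Distinct-recount [-] = [-]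
    Distinct-recount (A≢ ∷ l) = A≢ ∷ l

  IsFactorization : List Block → Set
  IsFactorization bs = All (λ b → 1 ≤ proj₂ b) bs × Linked Distinct bs

  consBlock-isFactorization : ∀ A {bs} → IsFactorization bs → IsFactorization (consBlock A bs)
  consBlock-isFactorization A ([] , []) = s≤s z≤n ∷ [] , [-]
  consBlock-isFactorization A {(B , k) ∷ bs} (1≤k ∷ pos , linked) with A ≟ₐ B
  ... | yes _ = s≤s z≤n ∷ pos , Distinct-recount linked
  ... | no A≢B = s≤s z≤n ∷ 1≤k ∷ pos , A≢B ∷ linked

  factor-isFactorization : ∀ xs → IsFactorization (factor φ xs)
  factor-isFactorization [] = [] , []
  factor-isFactorization (A ∷ xs) =
    subst IsFactorization (sym (factor-∷ A xs)) (consBlock-isFactorization A (factor-isFactorization xs))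

  consBlock-fresh : ∀ A m bs → Linked Distinct ((A , m) ∷ bs) → consBlock A bs ≡ (A , 1) ∷ bs
  consBlock-fresh A m [] [-] = refl
  consBlock-fresh A m ((B , k) ∷ bs) (A≢B ∷ _) with A ≟ₐ B
  ... | yes A≡B = ⊥-elim (A≢B A≡B)
  ... | no _ = refl

  factor-expand : ∀ {bs} → IsFactorization bs → factor φ (expand bs) ≡ bs
  factor-expand ([] , []) = refl
  factor-expand {(A , m) ∷ bs} (1≤m ∷ pos , linked) = factor-run m 1≤m linked
    where
    tail-linked : Linked Distinct bs
    tail-linked = Linked.tail linked
    factor-run : ∀ j → 1 ≤ j → Linked Distinct ((A , j) ∷ bs) → factor φ (replicate j A ++ expand bs) ≡ (A , j) ∷ bs
    factor-run 1 _ l = begin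
      factor φ (A ∷ expand bs)             ≡⟨ factor-∷ A (expand bs) ⟩
      consBlock A (factor φ (expand bs))   ≡⟨ cong (consBlock A) (factor-expand (pos , tail-linked)) ⟩
      consBlock A bs                       ≡⟨ consBlock-fresh A 1 bs l ⟩
      (A , 1) ∷ bs                         ∎
      where open ≡-Reasoning
    factor-run (suc (suc j)) _ l = begin
      factor φ (A ∷ replicate (suc j) A ++ expand bs)   ≡⟨ factor-∷ A (replicate (suc j) A ++ expand bs) ⟩
      consBlock A (factor φ (replicate (suc j) A ++ expand bs))
                                    ≡⟨ cong (consBlock A) (factor-run (suc j) (s≤s z≤n) (Distinct-recount l)) ⟩
      consBlock A ((A , suc j) ∷ bs)  ≡⟨ consBlock-same A (suc j) bs ⟩
      (A , suc (suc j)) ∷ bs           ∎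
      where open ≡-Reasoning

  truncate : Block → Block
  truncate (A , m) = A , m ⊓ (rank φ A + 1)

  contract : Row → Row
  contract xs = expand (map truncate (factor φ xs))

  contract-minimal : ∀ xs → Minimal φ (contract xs)
  contract-minimal xs =
    subst (All MinimalBlock) (sym (factor-expand (Allₚ.map⁺ (All.map (λ {b} → truncate-pos {b}) pos) , Linkedₚ.map⁺ linked)))
      (Allₚ.map⁺ (All.map (λ {b} → bounds {b}) pos))
    where
    pos : All (λ b → 1 ≤ proj₂ b) (factor φ xs)
    pos = proj₁ (factor-isFactorization xs)
    linked : Linked Distinct (factor φ xs)
    linked = proj₂ (factor-isFactorization xs)
    truncate-pos : ∀ {b} → 1 ≤ proj₂ b → 1 ≤ proj₂ (truncate b)
    truncate-pos {A , m} 1≤m = ⊓-glb 1≤m (m≤n+m 1 (rank φ A))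
    MinimalBlock : Block → Set
    MinimalBlock (A , m) = 1 ≤ m × m ≤ rank φ A + 1
    bounds : ∀ {b} → 1 ≤ proj₂ b → MinimalBlock (truncate b)
    bounds {A , m} 1≤m = truncate-pos {A , m} 1≤m , m⊓n≤n m (rank φ A + 1)

  shorten-replicate : ∀ A d Q → Star Shorten (replicate (suc (rank φ A) + d) A ++ Q) (replicate (suc (rank φ A)) A ++ Q)
  shorten-replicate A zero Q rewrite +-identityʳ (rank φ A) = ε
  shorten-replicate A (suc d) Q = first ◅ shorten-replicate A d Q
    where
    k : ℕ
    k = suc (rank φ A) + d
    first : Shorten (replicate (suc (rank φ A) + suc d) A ++ Q) (replicate k A ++ Q)
    first = subst (λ xs → Shorten xs (replicate k A ++ Q))
      (trans (replicate-∷ k A Q) (cong (λ j → replicate j A ++ Q) (sym (+-suc (suc (rank φ A)) d))))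
      (shorten [] A k Q (s≤s (m≤m+n (rank φ A) d)))

  shorten-run : ∀ A m Q → Star Shorten (replicate m A ++ Q) (replicate (m ⊓ (rank φ A + 1)) A ++ Q)
  shorten-run A m Q with m ≤? rank φ A + 1
  ... | yes m≤ = subst (λ j → Star Shorten (replicate m A ++ Q) (replicate j A ++ Q)) (sym (m≤n⇒m⊓n≡m m≤)) ε
  ... | no m≰ = subst₂ (λ i j → Star Shorten (replicate i A ++ Q) (replicate j A ++ Q))
                  (m+[n∸m]≡n r+1≤m) (trans (+-comm 1 (rank φ A)) (sym (m≥n⇒m⊓n≡n (<⇒≤ (≰⇒> m≰)))))
                  (shorten-replicate A (m ∸ suc (rank φ A)) Q)
    where
    r+1≤m : suc (rank φ A) ≤ m
    r+1≤m = subst (_≤ m) (+-comm (rank φ A) 1) (<⇒≤ (≰⇒> m≰))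

  shorten-expand : ∀ bs → Star Shorten (expand bs) (expand (map truncate bs))
  shorten-expand [] = ε
  shorten-expand ((A , m) ∷ bs) =
    Star.gmap (replicate m A ++_) (Shorten-++ˡ (replicate m A)) (shorten-expand bs)
    ◅◅ shorten-run A m (expand (map truncate bs))

  shorten-contract : ∀ xs → Star Shorten xs (contract xs)
  shorten-contract xs = subst (λ ys → Star Shorten ys (contract xs)) (expand-factor xs) (shorten-expand (factor φ xs))

  ∼⇒contract≡ : ∀ {xs ys} → _∼_ φ xs ys → contract xs ≡ contract ys
  ∼⇒contract≡ = cong expand ∘ truncate-cong
    where
    truncate-cong : ∀ {bs cs} → Pointwise (BlockEq φ) bs cs → map truncate bs ≡ map truncate cs
    truncate-cong [] = refl
    truncate-cong ((refl , inj₁ refl) ∷ bs≈cs) = cong (_ ∷_) (truncate-cong bs≈cs)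
    truncate-cong (_∷_ {x = A , m} {y = .A , m′} (refl , inj₂ (lt , lt′)) bs≈cs) =
      cong₂ _∷_ (cong (A ,_) (trans (m≥n⇒m⊓n≡n (r+1≤ lt)) (sym (m≥n⇒m⊓n≡n (r+1≤ lt′))))) (truncate-cong bs≈cs)
      where
      r+1≤ : ∀ {k} → rank φ A < k → rank φ A + 1 ≤ k
      r+1≤ {k} = subst (_≤ k) (+-comm 1 (rank φ A))

  ≈-contract : ∀ xs → xs ≈ contract xs
  ≈-contract xs = Star.map fwd (shorten-contract xs)

  ∼⇒≈ : ∀ {xs ys} → _∼_ φ xs ys → xs ≈ ys
  ∼⇒≈ {xs} {ys} xs∼ys =
    ≈-contract xs ◅◅ subst (_≈ ys) (sym (∼⇒contract≡ {xs} {ys} xs∼ys)) (≈-sym (≈-contract ys))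

  -- Successors respect ∼

  data Run : Row → Atom φ → Row → Atom φ → Set where
    []  : ∀ {B} → Run [] B [] B
    _∷_ : ∀ {R xs B B′ T C} → Gen φ R B B′ → Run xs B′ T C → Run (R ∷ xs) B (B ∷ T) C

  Succ⇒Run : ∀ {xs B S} → Succ φ xs B S → ∃₂ λ T C → Run xs B T C × S ≡ T ∷ʳ C
  Succ⇒Run done = [] , _ , [] , refl
  Succ⇒Run (step g s) with Succ⇒Run s
  ... | T , C , r , refl = _ ∷ T , C , g ∷ r , refl

  Run⇒Succ : ∀ {xs B T C} → Run xs B T C → Succ φ xs B (T ∷ʳ C)
  Run⇒Succ [] = done
  Run⇒Succ (g ∷ r) = step g (Run⇒Succ r)

  Run-++⁻ : ∀ xs {ys B T C} → Run (xs ++ ys) B T C →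
            ∃₂ λ T₁ Y → ∃ λ T₂ → Run xs B T₁ Y × Run ys Y T₂ C × T ≡ T₁ ++ T₂
  Run-++⁻ [] r = [] , _ , _ , [] , r , refl
  Run-++⁻ (_ ∷ xs) (g ∷ r) with Run-++⁻ xs r
  ... | T₁ , Y , T₂ , r₁ , r₂ , refl = _ ∷ T₁ , Y , T₂ , g ∷ r₁ , r₂ , refl

  Run-++⁺ : ∀ {xs ys B T₁ Y T₂ C} → Run xs B T₁ Y → Run ys Y T₂ C → Run (xs ++ ys) B (T₁ ++ T₂) C
  Run-++⁺ [] r₂ = r₂
  Run-++⁺ (g ∷ r₁) r₂ = g ∷ Run-++⁺ r₁ r₂

  Run-∷ʳ⁻ : ∀ xs {R B T C} → Run (xs ∷ʳ R) B T C →
            ∃₂ λ T′ Y → Run xs B T′ Y × Gen φ R Y C × T ≡ T′ ∷ʳ Y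
  Run-∷ʳ⁻ xs r with Run-++⁻ xs r
  ... | T′ , Y , _ , r′ , g ∷ [] , refl = T′ , Y , r′ , g , refl

  Run-trace-head : ∀ {xs Z T C} → Run xs Z T C → ∃ λ rest → T ∷ʳ C ≡ Z ∷ rest
  Run-trace-head [] = [] , refl
  Run-trace-head (_∷_ {T = T} {C} g r) = T ∷ʳ C , refl

  Fixed : Atom φ → Atom φ → Set
  Fixed X Z = Gen φ X Z Z

  Gen⇒⊇APˡ : ∀ {X Y Z} → Gen φ X Y Z → _⊇AP_ φ X Z
  Gen⇒⊇APˡ (_ , var⇔ , _) p = proj₁ ∘ to (var⇔ p)

  Gen-rank-stable : ∀ {X Y Z} → IsAtom φ Y → _⊇AP_ φ X Y → Gen φ X Y Z → ¬ rank φ Z < rank φ Y → Z ≡ Y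
  Gen-rank-stable {X} {Y} {Z} atomY X⊇Y g ≮ = atom-ext (proj₁ g) atomY
    (λ p → mk⇔ (proj₂ ∘ to (proj₁ (proj₂ g) p)) (λ ∈Y → from (proj₁ (proj₂ g) p) (X⊇Y p ∈Y , ∈Y)))
    (λ ψ → mk⇔ (Z⊆Y ψ) (proj₁ (Gen⇒⊆Req∪Obsʳ {X} {Y} {Z} g) ψ))
    where
    Z⊆Y : _⊆Req_ Z Y
    Z⊆Y ψ ∈Z with _∈ₐ?_ (⟨D⟩ ψ) Y
    ... | yes ∈Y = ∈Y
    ... | no ∉Y = contradiction (rank-strict {Y} {Z} ψ (proj₁ (Gen⇒⊆Req∪Obsʳ {X} {Y} {Z} g)) ∈Z ∉Y) ≮

  rank≡0⇒Fixed : ∀ {X Z} → IsAtom φ Z → _⊇AP_ φ X Z → rank φ Z ≡ 0 → Fixed X Z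
  rank≡0⇒Fixed {X} {Z} atomZ X⊇Z rank≡0 =
    atomZ , (λ p → mk⇔ (λ ∈Z → X⊇Z p ∈Z , ∈Z) proj₂) , (λ ψ → mk⇔ (inj₂ ∘ inj₁) (requested ψ))
    where
    full : ∀ ψ → InREQ φ ψ → (⟨D⟩ ψ) ∈ₐ Z
    full ψ = rank≡0⇒requests-REQ Z ψ rank≡0
    requested : ∀ ψ → GeneratedRequest X Z ψ → (⟨D⟩ ψ) ∈ₐ Z
    requested ψ (inj₁ ∈X) = full ψ (∈A⇒∈CL {X} (⟨D⟩ ψ) ∈X)
    requested ψ (inj₂ (inj₁ ∈Z)) = ∈Z
    requested ψ (inj₂ (inj₂ (inj₁ (_ , r)))) = full ψ r
    requested ψ (inj₂ (inj₂ (inj₂ (_ , r)))) = full ψ r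

  -- Each step along X^k either lowers rank Z, starting a new final block, or leaves Z
  -- unchanged (Gen-rank-stable), which makes Z a fixed point of generation from X.
  record RunTail (X : Atom φ) (k : ℕ) (T : Row) (Z : Atom φ) : Set where
    field
      atom : IsAtom φ Z
      letters : _⊇AP_ φ X Z
      prefix : Row
      j : ℕ
      trace≡ : T ∷ʳ Z ≡ prefix ++ replicate j Z
      rank-bound : rank φ Z + k ≤ j + rank φ X
      fixed⊎j≡1 : Fixed X Z ⊎ j ≡ 1

  RunTail-extend : ∀ {X k T Z} → RunTail X k T Z → Fixed X Z → RunTail X (suc k) (T ∷ʳ Z) Z
  RunTail-extend {X} {k} {T} {Z} t fixed = record
    { atom = atom ; letters = letters ; prefix = prefix ; j = suc j
    ; trace≡ = begin
        T ∷ʳ Z ∷ʳ Z                      ≡⟨ cong (_∷ʳ Z) trace≡ ⟩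
        (prefix ++ replicate j Z) ∷ʳ Z   ≡⟨ ++-assoc prefix (replicate j Z) [ Z ] ⟩
        prefix ++ replicate j Z ∷ʳ Z     ≡⟨ cong (prefix ++_) (replicate-∷ʳ j Z) ⟩
        prefix ++ replicate (suc j) Z    ∎
    ; rank-bound = subst (_≤ suc j + rank φ X) (sym (+-suc (rank φ Z) k)) (s≤s rank-bound)
    ; fixed⊎j≡1 = inj₁ fixed
    }
    where
    open RunTail t
    open ≡-Reasoning

  Run-replicate-tail : ∀ X k {Y T Z} → Run (replicate (suc k) X) Y T Z → RunTail X (suc k) T Z
  Run-replicate-tail X zero {Y} {Z = Z} (g ∷ []) = record
    { atom = proj₁ g ; letters = Gen⇒⊇APˡ {X} {Y} {Z} g ; prefix = [ Y ] ; j = 1 ; trace≡ = refl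
    ; rank-bound = subst (_≤ 1 + rank φ X) (+-comm 1 (rank φ Z))
                     (s≤s (rank-antitone {X} {Z} (proj₁ (Gen⇒⊆Req∪Obsˡ {X} {Y} {Z} g))))
    ; fixed⊎j≡1 = inj₂ refl
    }
  Run-replicate-tail X (suc k) {Y} {T} {Z′} r
    with Run-∷ʳ⁻ (replicate (suc k) X) (subst (λ xs → Run xs Y T Z′) (sym (replicate-∷ʳ (suc k) X)) r)
  ... | T′ , Z , r′ , g , refl = RunTail-step (Run-replicate-tail X k r′) g
    where
    RunTail-step : ∀ {T′ Z Z′} → RunTail X (suc k) T′ Z → Gen φ X Z Z′ → RunTail X (suc (suc k)) (T′ ∷ʳ Z) Z′
    RunTail-step {T′} {Z} {Z′} t g with RunTail.fixed⊎j≡1 t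
    ... | inj₁ fixed with Gen-functional {X} {Z} {Z} {Z′} fixed g
    ...   | refl = RunTail-extend t fixed
    RunTail-step {T′} {Z} {Z′} t g | inj₂ j≡1 with rank φ Z′ <? rank φ Z
    ... | yes lt = record
      { atom = proj₁ g ; letters = Gen⇒⊇APˡ {X} {Z} {Z′} g ; prefix = T′ ∷ʳ Z ; j = 1 ; trace≡ = refl
      ; rank-bound = ≤-trans (subst (_≤ rank φ Z + suc k) (sym (+-suc (rank φ Z′) (suc k))) (+-monoˡ-≤ (suc k) lt))
                             (subst (λ i → rank φ Z + suc k ≤ i + rank φ X) j≡1 (RunTail.rank-bound t))
      ; fixed⊎j≡1 = inj₂ refl
      }
    ... | no ≮ with Gen-rank-stable {X} {Z} {Z′} (RunTail.atom t) (RunTail.letters t) g ≮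
    ...   | refl = RunTail-extend t g

  Run-replicate-fixed : ∀ {X k Y T Z} → rank φ X < k → Run (replicate k X) Y T Z →
                        Fixed X Z × ∃₂ λ pre j → T ∷ʳ Z ≡ pre ++ replicate j Z × rank φ Z < j
  Run-replicate-fixed {X} {suc k} {Z = Z} lt r with Run-replicate-tail X k r
  ... | t with RunTail.fixed⊎j≡1 t
  ...   | inj₁ fixed = fixed , prefix , j , trace≡ , +-cancelʳ-< (suc k) (rank φ Z) j (≤-<-trans rank-bound (+-monoʳ-< j lt))
    where open RunTail t
  ...   | inj₂ refl = rank≡0⇒Fixed {X} {Z} atom letters rank≡0 , prefix , 1 , trace≡ , subst (_< 1) (sym rank≡0) (s≤s z≤n)
    where
    open RunTail t
    rank≡0 : rank φ Z ≡ 0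
    rank≡0 = n<1⇒n≡0 (+-cancelʳ-< (suc k) (rank φ Z) 1 (≤-<-trans rank-bound (+-monoʳ-< 1 lt)))

  pumped-trace≡ : ∀ (T₁ T₂ T₃ : Row) {C Z pre j rest} →
               T₂ ∷ʳ Z ≡ pre ++ replicate j Z → T₃ ∷ʳ C ≡ Z ∷ rest →
               (T₁ ++ T₂ ++ T₃) ∷ʳ C ≡ (T₁ ++ pre) ++ replicate j Z ++ rest
  pumped-trace≡ T₁ T₂ T₃ {C} {Z} {pre} {j} {rest} e₂ e₃ = begin
    (T₁ ++ T₂ ++ T₃) ∷ʳ C                 ≡⟨ ++-assoc T₁ (T₂ ++ T₃) [ C ] ⟩
    T₁ ++ (T₂ ++ T₃) ∷ʳ C                 ≡⟨ cong (T₁ ++_) (++-assoc T₂ T₃ [ C ]) ⟩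
    T₁ ++ T₂ ++ T₃ ∷ʳ C                   ≡⟨ cong (λ R → T₁ ++ T₂ ++ R) e₃ ⟩
    T₁ ++ T₂ ++ Z ∷ rest                  ≡⟨ cong (T₁ ++_) (++-assoc T₂ [ Z ] rest) ⟨
    T₁ ++ (T₂ ∷ʳ Z) ++ rest               ≡⟨ cong (λ R → T₁ ++ R ++ rest) e₂ ⟩
    T₁ ++ (pre ++ replicate j Z) ++ rest  ≡⟨ cong (T₁ ++_) (++-assoc pre (replicate j Z) rest) ⟩
    T₁ ++ pre ++ replicate j Z ++ rest    ≡⟨ ++-assoc T₁ pre (replicate j Z ++ rest) ⟨
    (T₁ ++ pre) ++ replicate j Z ++ rest  ∎
    where open ≡-Reasoning

  Run-pump-Shorten : ∀ T₁ {X k Y T₂ Z Q T₃ C} → rank φ X < k → Run (replicate k X) Y T₂ Z → Run Q Z T₃ C →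
               Shorten ((T₁ ++ T₂ ++ Z ∷ T₃) ∷ʳ C) ((T₁ ++ T₂ ++ T₃) ∷ʳ C)
  Run-pump-Shorten T₁ {T₂ = T₂} {Z} {T₃ = T₃} lt r₂ r₃ with Run-replicate-fixed lt r₂ | Run-trace-head r₃
  ... | _ , pre , j , e₂ , rank<j | rest , e₃ =
    subst₂ Shorten (sym (pumped-trace≡ T₁ T₂ (Z ∷ T₃) e₂ (cong (Z ∷_) e₃))) (sym (pumped-trace≡ T₁ T₂ T₃ e₂ e₃))
      (shorten (T₁ ++ pre) Z j rest rank<j)

  Run-insert : ∀ {xs ys B T C} → Shorten xs ys → Run ys B T C →
               ∃ λ T′ → Run xs B T′ C × Shorten (T′ ∷ʳ C) (T ∷ʳ C)
  Run-insert (shorten P X k Q lt) r with Run-++⁻ P r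
  ... | T₁ , _ , _ , r₁ , r₂₃ , refl with Run-++⁻ (replicate k X) r₂₃
  ...   | T₂ , Z , T₃ , r₂ , r₃ , refl =
    T₁ ++ T₂ ++ Z ∷ T₃ , Run-++⁺ r₁ (Run-++⁺ r₂ (proj₁ (Run-replicate-fixed lt r₂) ∷ r₃)) , Run-pump-Shorten T₁ lt r₂ r₃

  Run-delete : ∀ {xs ys B T′ C} → Shorten xs ys → Run xs B T′ C →
               ∃ λ T → Run ys B T C × Shorten (T′ ∷ʳ C) (T ∷ʳ C)
  Run-delete (shorten P X k Q lt) r with Run-++⁻ P r
  ... | T₁ , _ , _ , r₁ , r₂₃ , refl with Run-++⁻ (replicate k X) r₂₃
  ...   | T₂ , Z , _ , r₂ , _∷_ {B′ = Z′} g r₃ , refl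
          with Gen-functional {X} {Z} {Z} {Z′} (proj₁ (Run-replicate-fixed lt r₂)) g
  ...     | refl = T₁ ++ T₂ ++ _ , Run-++⁺ r₁ (Run-++⁺ r₂ r₃) , Run-pump-Shorten T₁ lt r₂ r₃

  Run-resp-≈ : ∀ {xs ys B T C} → xs ≈ ys → Run ys B T C →
               ∃ λ T′ → Run xs B T′ C × T′ ∷ʳ C ≈ T ∷ʳ C
  Run-resp-≈ ε r = _ , r , ε
  Run-resp-≈ (fwd s ◅ p) r with Run-resp-≈ p r
  ... | _ , r₁ , q with Run-insert s r₁
  ...   | T′ , r′ , s′ = T′ , r′ , fwd s′ ◅ q
  Run-resp-≈ (bwd s ◅ p) r with Run-resp-≈ p r
  ... | _ , r₁ , q with Run-delete s r₁
  ...   | T′ , r′ , s′ = T′ , r′ , bwd s′ ◅ q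

  Succ-resp-≈ : ∀ {xs ys A S} → xs ≈ ys → Succ φ ys A S → ∃ λ S′ → Succ φ xs A S′ × S′ ≈ S
  Succ-resp-≈ p s with Succ⇒Run s
  ... | _ , C , r , refl with Run-resp-≈ p r
  ...   | T′ , r′ , q = T′ ∷ʳ C , Run⇒Succ r′ , q

  -- Compass structures over initial segments of ℕ

  record IsNatCompass (M : ℕ) (L : ℕ → ℕ → Atom φ) : Set where
    field
      atom : ∀ x y → x ≤ y → y ≤ M → IsAtom φ (L x y)
      D-inside : ∀ x y x′ y′ → y ≤ M → StrictlyInside x y x′ y′ → L x y Dφ L x′ y′
      fulfilling : ∀ x y → x ≤ y → y ≤ M → ∀ ψ → (⟨D⟩ ψ) ∈ₐ L x y →
                   ∃₂ λ x′ y′ → StrictlyInside x y x′ y′ × ψ ∈ₐ L x′ y′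
      homogeneous : ∀ x y → x ≤ y → y ≤ M → ∀ p →
                    var p ∈ₐ L x y ⇔ (∀ x′ → x ≤ x′ → x′ ≤ y → var p ∈ₐ L x′ x′)

  extendLabelling : ∀ M → Labelling φ (suc M) → ℕ → ℕ → Atom φ
  extendLabelling M L x y = L (clamp M x) (clamp M y)

  restrictLabelling : ∀ M → (ℕ → ℕ → Atom φ) → Labelling φ (suc M)
  restrictLabelling M L x y = L (toℕ x) (toℕ y)

  module _ (M : ℕ) (L : Labelling φ (suc M))
           (compass : IsCompass φ L) (hom : Homogeneous φ L) (ful : Fulfilling φ L) where

    private
      clamp-≤ : ∀ {x y} → x ≤ y → y ≤ M → clamp M x Fin.≤ clamp M y
      clamp-≤ {x} {y} x≤y y≤M = subst₂ _≤_ (sym (toℕ-clamp (≤-trans x≤y y≤M))) (sym (toℕ-clamp y≤M)) x≤y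

    Features-extend : ∀ {ψ} → Features φ L ψ → ∃₂ λ x y → x ≤ y × y ≤ M × ψ ∈ₐ L (clamp M x) (clamp M y)
    Features-extend {ψ} (x , y , x≤y , ψ∈) =
      toℕ x , toℕ y , x≤y , toℕ≤pred y , subst₂ (λ a b → ψ ∈ₐ L a b) (sym (clamp-toℕ x)) (sym (clamp-toℕ y)) ψ∈

    Compass⇒IsNatCompass : IsNatCompass M (extendLabelling M L)
    Compass⇒IsNatCompass = record { atom = atom ; D-inside = D-inside ; fulfilling = fulfilling ; homogeneous = homogeneous }
      where
      atom : ∀ x y → x ≤ y → y ≤ M → IsAtom φ (L (clamp M x) (clamp M y))
      atom x y x≤y y≤M = proj₁ compass (clamp M x) (clamp M y) (clamp-≤ x≤y y≤M)

      D-inside : ∀ x y x′ y′ → y ≤ M → StrictlyInside x y x′ y′ →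
                 L (clamp M x) (clamp M y) Dφ L (clamp M x′) (clamp M y′)
      D-inside x y x′ y′ y≤M (x≤x′ , x′≤y′ , y′≤y , ≢) =
        proj₂ compass (clamp M x) (clamp M y) (clamp M x′) (clamp M y′)
          (clamp-≤ (≤-trans x≤x′ (≤-trans x′≤y′ y′≤y)) y≤M) (clamp-≤ x′≤y′ y′≤M)
          (clamp-≤ x≤x′ x′≤M , clamp-≤ y′≤y y≤M ,
           λ (e₁ , e₂) → ≢ (trans (sym (toℕ-clamp x′≤M)) (trans (cong toℕ e₁) (toℕ-clamp x≤M))
                          , trans (sym (toℕ-clamp y′≤M)) (trans (cong toℕ e₂) (toℕ-clamp y≤M))))
        where
        y′≤M : y′ ≤ M
        y′≤M = ≤-trans y′≤y y≤M
        x′≤M : x′ ≤ M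
        x′≤M = ≤-trans x′≤y′ y′≤M
        x≤M : x ≤ M
        x≤M = ≤-trans x≤x′ x′≤M

      fulfilling : ∀ x y → x ≤ y → y ≤ M → ∀ ψ → (⟨D⟩ ψ) ∈ₐ L (clamp M x) (clamp M y) →
                   ∃₂ λ x′ y′ → StrictlyInside x y x′ y′ × ψ ∈ₐ L (clamp M x′) (clamp M y′)
      fulfilling x y x≤y y≤M ψ h with ful (clamp M x) (clamp M y) (clamp-≤ x≤y y≤M) ψ h
      ... | i , j , i≤j , (x≤i , j≤y , ≢) , ψ∈ =
        toℕ i , toℕ j ,
        (subst (_≤ toℕ i) (toℕ-clamp x≤M) x≤i , i≤j , subst (toℕ j ≤_) (toℕ-clamp y≤M) j≤y ,
         λ (e₁ , e₂) → ≢ (toℕ-injective (trans e₁ (sym (toℕ-clamp x≤M))) , toℕ-injective (trans e₂ (sym (toℕ-clamp y≤M))))) ,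
        subst₂ (λ a b → ψ ∈ₐ L a b) (sym (clamp-toℕ i)) (sym (clamp-toℕ j)) ψ∈
        where
        x≤M : x ≤ M
        x≤M = ≤-trans x≤y y≤M

      homogeneous : ∀ x y → x ≤ y → y ≤ M → ∀ p →
                    var p ∈ₐ L (clamp M x) (clamp M y) ⇔ (∀ x′ → x ≤ x′ → x′ ≤ y → var p ∈ₐ L (clamp M x′) (clamp M x′))
      homogeneous x y x≤y y≤M p = mk⇔
        (λ h x′ x≤x′ x′≤y → let e = toℕ-clamp (≤-trans x′≤y y≤M) in
           to hom′ h (clamp M x′) (subst₂ _≤_ (sym (toℕ-clamp x≤M)) (sym e) x≤x′) (subst₂ _≤_ (sym e) (sym (toℕ-clamp y≤M)) x′≤y))
        (λ h → from hom′ λ i x≤i i≤y →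
           subst (λ a → var p ∈ₐ L a a) (clamp-toℕ i)
             (h (toℕ i) (subst (_≤ toℕ i) (toℕ-clamp x≤M) x≤i) (subst (toℕ i ≤_) (toℕ-clamp y≤M) i≤y)))
        where
        x≤M : x ≤ M
        x≤M = ≤-trans x≤y y≤M
        hom′ : var p ∈ₐ L (clamp M x) (clamp M y) ⇔ (∀ i → clamp M x Fin.≤ i → i Fin.≤ clamp M y → var p ∈ₐ L i i)
        hom′ = hom (clamp M x) (clamp M y) (clamp-≤ x≤y y≤M) p

  module _ (M : ℕ) (L : ℕ → ℕ → Atom φ) (nat : IsNatCompass M L) where

    open IsNatCompass nat

    private
      L′ : Labelling φ (suc M)
      L′ = restrictLabelling M L

      fromℕ≤ : ∀ {x} → x ≤ M → Fin (suc M)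
      fromℕ≤ x≤M = fromℕ< (s≤s x≤M)

      toℕ-fromℕ≤ : ∀ {x} (x≤M : x ≤ M) → toℕ (fromℕ≤ x≤M) ≡ x
      toℕ-fromℕ≤ x≤M = toℕ-fromℕ< (s≤s x≤M)

    Features-restrict : ∀ {ψ x y} → x ≤ y → y ≤ M → ψ ∈ₐ L x y → Features φ L′ ψ
    Features-restrict {ψ} x≤y y≤M ψ∈ =
      fromℕ≤ (≤-trans x≤y y≤M) , fromℕ≤ y≤M ,
      subst₂ _≤_ (sym (toℕ-fromℕ≤ (≤-trans x≤y y≤M))) (sym (toℕ-fromℕ≤ y≤M)) x≤y ,
      subst₂ (λ a b → ψ ∈ₐ L a b) (sym (toℕ-fromℕ≤ (≤-trans x≤y y≤M))) (sym (toℕ-fromℕ≤ y≤M)) ψ∈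

    IsNatCompass⇒Compass : IsCompass φ L′ × Homogeneous φ L′ × Fulfilling φ L′
    IsNatCompass⇒Compass = compass , homogeneous′ , fulfilling′
      where
      compass : IsCompass φ L′
      compass = (λ x y x≤y → atom (toℕ x) (toℕ y) x≤y (toℕ≤pred y))
              , (λ x y x′ y′ _ x′≤y′ (x≤x′ , y′≤y , ≢) → D-inside (toℕ x) (toℕ y) (toℕ x′) (toℕ y′) (toℕ≤pred y)
                   (x≤x′ , x′≤y′ , y′≤y , λ (e₁ , e₂) → ≢ (toℕ-injective e₁ , toℕ-injective e₂)))

      homogeneous′ : Homogeneous φ L′
      homogeneous′ x y x≤y p = mk⇔
        (λ h i x≤i i≤y → to hom′ h (toℕ i) x≤i i≤y)
        (λ h → from hom′ λ x′ x≤x′ x′≤y →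
           let x′≤M = ≤-trans x′≤y (toℕ≤pred y) ; e = toℕ-fromℕ≤ x′≤M in
           subst (λ a → var p ∈ₐ L a a) e
             (h (fromℕ≤ x′≤M) (subst (toℕ x ≤_) (sym e) x≤x′) (subst (_≤ toℕ y) (sym e) x′≤y)))
        where
        hom′ : var p ∈ₐ L (toℕ x) (toℕ y) ⇔ (∀ x′ → toℕ x ≤ x′ → x′ ≤ toℕ y → var p ∈ₐ L x′ x′)
        hom′ = homogeneous (toℕ x) (toℕ y) x≤y (toℕ≤pred y) p

      fulfilling′ : Fulfilling φ L′
      fulfilling′ x y x≤y ψ h with fulfilling (toℕ x) (toℕ y) x≤y (toℕ≤pred y) ψ h
      ... | x′ , y′ , (x≤x′ , x′≤y′ , y′≤y , ≢) , ψ∈ =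
        fromℕ≤ x′≤M , fromℕ≤ y′≤M ,
        subst₂ _≤_ (sym ex) (sym ey) x′≤y′ ,
        (subst (toℕ x ≤_) (sym ex) x≤x′ , subst (_≤ toℕ y) (sym ey) y′≤y ,
         λ (e₁ , e₂) → ≢ (trans (sym ex) (cong toℕ e₁) , trans (sym ey) (cong toℕ e₂))) ,
        subst₂ (λ a b → ψ ∈ₐ L a b) (sym ex) (sym ey) ψ∈
        where
        y′≤M : y′ ≤ M
        y′≤M = ≤-trans y′≤y (toℕ≤pred y)
        x′≤M : x′ ≤ M
        x′≤M = ≤-trans x′≤y′ y′≤M
        ex : toℕ (fromℕ≤ x′≤M) ≡ x′
        ex = toℕ-fromℕ≤ x′≤M
        ey : toℕ (fromℕ≤ y′≤M) ≡ y′
        ey = toℕ-fromℕ≤ y′≤M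

  -- From compass structures to paths in G^min_φ

  module Columns (M : ℕ) (L : ℕ → ℕ → Atom φ) (nat : IsNatCompass M L) where

    open IsNatCompass nat

    observed-below : ∀ {x y x′ y′} ψ → y ≤ M → x ≤ x′ → x′ ≤ y′ → y′ ≤ y → InREQ φ ψ →
                     ψ ∈ₐ L x′ y′ → (ψ ∈ₐ L x y) ⊎ ((⟨D⟩ ψ) ∈ₐ L x y)
    observed-below {x} {y} {x′} {y′} ψ y≤M x≤x′ x′≤y′ y′≤y r ψ∈ with inside-or-equal x≤x′ x′≤y′ y′≤y
    ... | inj₁ (refl , refl) = inj₁ ψ∈
    ... | inj₂ inside = inj₂ (proj₂ (to (D⇔⊆Req∪Obs {L x y} {L x′ y′}
            (atom x y x≤y y≤M) (atom x′ y′ x′≤y′ (≤-trans y′≤y y≤M)) ) (D-inside x y x′ y′ y≤M inside)) ψ r ψ∈)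
      where
      x≤y : x ≤ y
      x≤y = ≤-trans x≤x′ (≤-trans x′≤y′ y′≤y)

    Gen-adjacent : ∀ x y → x ≤ y → suc y ≤ M → Gen φ (L x y) (L (suc x) (suc y)) (L x (suc y))
    Gen-adjacent x y x≤y y<M = atom x (suc y) x≤y+1 y<M , var-clause , ⟨D⟩-clause
      where
      x≤y+1 : x ≤ suc y
      x≤y+1 = m≤n⇒m≤1+n x≤y
      y≤M : y ≤ M
      y≤M = ≤-trans (n≤1+n y) y<M
      Homogeneous-on : ℕ → ℕ → Set
      Homogeneous-on x y = ∀ p → var p ∈ₐ L x y ⇔ (∀ z → x ≤ z → z ≤ y → var p ∈ₐ L z z)
      hom-left : Homogeneous-on x y
      hom-left = homogeneous x y x≤y y≤M
      hom-right : Homogeneous-on (suc x) (suc y)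
      hom-right = homogeneous (suc x) (suc y) (s≤s x≤y) y<M
      hom-whole : Homogeneous-on x (suc y)
      hom-whole = homogeneous x (suc y) x≤y+1 y<M

      var-clause : ∀ p → var p ∈ₐ L x (suc y) ⇔ (var p ∈ₐ L x y × var p ∈ₐ L (suc x) (suc y))
      var-clause p = ⇔.trans (hom-whole p) (⇔.trans (∀-interval-split x≤y) (⇔.sym (hom-left p ×-⇔ hom-right p)))

      ⟨D⟩-clause : ∀ ψ → (⟨D⟩ ψ) ∈ₐ L x (suc y) ⇔ GeneratedRequest (L x y) (L (suc x) (suc y)) ψ
      ⟨D⟩-clause ψ = mk⇔ witnessed collected
        where
        whole⊆left : L x y ⊆Req∪Obs L x (suc y)
        whole⊆left = to (D⇔⊆Req∪Obs {L x (suc y)} {L x y} (atom x (suc y) x≤y+1 y<M) (atom x y x≤y y≤M))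
          (D-inside x (suc y) x y y<M (StrictlyInside-left x≤y))
        whole⊆right : L (suc x) (suc y) ⊆Req∪Obs L x (suc y)
        whole⊆right = to (D⇔⊆Req∪Obs {L x (suc y)} {L (suc x) (suc y)} (atom x (suc y) x≤y+1 y<M) (atom (suc x) (suc y) (s≤s x≤y) y<M))
          (D-inside x (suc y) (suc x) (suc y) y<M (StrictlyInside-right (s≤s x≤y)))

        collected : GeneratedRequest (L x y) (L (suc x) (suc y)) ψ → (⟨D⟩ ψ) ∈ₐ L x (suc y)
        collected (inj₁ h) = proj₁ whole⊆left ψ h
        collected (inj₂ (inj₁ h)) = proj₁ whole⊆right ψ h
        collected (inj₂ (inj₂ (inj₁ (h , r)))) = proj₂ whole⊆left ψ r h
        collected (inj₂ (inj₂ (inj₂ (h , r)))) = proj₂ whole⊆right ψ r h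

        witnessed : (⟨D⟩ ψ) ∈ₐ L x (suc y) → GeneratedRequest (L x y) (L (suc x) (suc y)) ψ
        witnessed h with fulfilling x (suc y) x≤y+1 y<M ψ h
        ... | x′ , y′ , (x≤x′ , x′≤y′ , y′≤y+1 , ≢) , ψ∈ with m≤n⇒m<n∨m≡n y′≤y+1
        ...   | inj₁ (s≤s y′≤y) =
          Sum.[ (λ ∈left → inj₂ (inj₂ (inj₁ (∈left , r)))) , inj₁ ]′ (observed-below ψ y≤M x≤x′ x′≤y′ y′≤y r ψ∈)
          where
          r : InREQ φ ψ
          r = ∈A⇒∈CL {L x (suc y)} (⟨D⟩ ψ) h
        ...   | inj₂ refl =
          Sum.[ (λ ∈right → inj₂ (inj₂ (inj₂ (∈right , r)))) , inj₂ ∘ inj₁ ]′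
            (observed-below ψ y<M x<x′ x′≤y′ ≤-refl r ψ∈)
          where
          r : InREQ φ ψ
          r = ∈A⇒∈CL {L x (suc y)} (⟨D⟩ ψ) h
          x<x′ : suc x ≤ x′
          x<x′ = ≤∧≢⇒< x≤x′ λ x≡x′ → ≢ (sym x≡x′ , refl)

    -- column y x lists the labels of (x, y), (x - 1, y), …, (0, y); row[i] of column y y labels (y - i, y).
    column : ℕ → ℕ → Row
    column y zero = L 0 y ∷ []
    column y (suc x) = L (suc x) y ∷ column y x

    column-Succ : ∀ y x → x ≤ y → suc y ≤ M → Succ φ (column y x) (L (suc x) (suc y)) (column (suc y) (suc x))
    column-Succ y zero _ y<M = step (Gen-adjacent 0 y z≤n y<M) done
    column-Succ y (suc x) x<y y<M = step (Gen-adjacent (suc x) y x<y y<M) (column-Succ y x (≤-trans (n≤1+n x) x<y) y<M)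

    column-atoms : ∀ y x → x ≤ y → y ≤ M → All (IsAtom φ) (column y x)
    column-atoms y zero _ y≤M = atom 0 y z≤n y≤M ∷ []
    column-atoms y (suc x) x<y y≤M = atom (suc x) y x<y y≤M ∷ column-atoms y x (≤-trans (n≤1+n x) x<y) y≤M

    column-step : ∀ y x → suc x ≤ y → y ≤ M → RowStep φ (L (suc x) y) (L x y)
    column-step y x x<y y≤M =
      D-inside x y (suc x) y y≤M (StrictlyInside-right x<y) ,
      λ p ∈xy → from (homogeneous (suc x) y x<y y≤M p)
        λ x′ x<x′ x′≤y → to (homogeneous x y (≤-trans (n≤1+n x) x<y) y≤M p) ∈xy x′ (≤-trans (n≤1+n x) x<x′) x′≤y

    column-linked : ∀ y x → x ≤ y → y ≤ M → Linked (RowStep φ) (column y x)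
    column-linked y zero _ _ = [-]
    column-linked y (suc zero) 1≤y y≤M = column-step y 0 1≤y y≤M ∷ [-]
    column-linked y (suc (suc x)) x<y y≤M =
      column-step y (suc x) x<y y≤M ∷ column-linked y (suc x) (≤-trans (n≤1+n (suc x)) x<y) y≤M

    column-∋ : ∀ {P : Atom φ → Set} y x x′ → x′ ≤ x → P (L x′ y) → Any P (column y x)
    column-∋ y zero zero _ px = here px
    column-∋ y (suc x) x′ x′≤x px with m≤n⇒m<n∨m≡n x′≤x
    ... | inj₁ (s≤s x′≤x-1) = there (column-∋ y x x′ x′≤x-1 px)
    ... | inj₂ refl = here px

    no-request-at-point : ∀ y → y ≤ M → ∀ ψ → ¬ (⟨D⟩ ψ) ∈ₐ L y y
    no-request-at-point y y≤M ψ h with fulfilling y y ≤-refl y≤M ψ h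
    ... | x′ , y′ , (y≤x′ , x′≤y′ , y′≤y , ≢) , _ =
      ≢ (≤-antisym (≤-trans x′≤y′ y′≤y) y≤x′ , ≤-antisym y′≤y (≤-trans y≤x′ x′≤y′))

    contracted : ℕ → Row
    contracted y = contract (column y y)

    column≈contracted : ∀ y → column y y ≈ contracted y
    column≈contracted y = ≈-contract (column y y)

    contracted-head : ∀ y → ∃ λ r → contracted y ≡ L y y ∷ r
    contracted-head y = Star-Shorten-preserves (λ zs → ∃ λ r → zs ≡ L y y ∷ r) keeps-head (shorten-contract (column y y)) (column-head y)
      where
      column-head : ∀ y → ∃ λ r → column y y ≡ L y y ∷ r
      column-head zero = [] , refl
      column-head (suc y) = column (suc y) y , refl
      keeps-head : MergeClosed (λ zs → ∃ λ r → zs ≡ L y y ∷ r)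
      keeps-head [] X Q (_ , refl) = Q , refl
      keeps-head (_ ∷ P) X Q (_ , refl) = P ++ X ∷ Q , refl

    contracted-vertex : ∀ y → y ≤ M → Vertex φ (contracted y)
    contracted-vertex y y≤M with contracted-head y
    ... | r , e = (subst (λ zs → 0 < length zs) (sym e) (s≤s z≤n)
                  , Star-Shorten-preserves (All (IsAtom φ)) All-merge shortening (column-atoms y y ≤-refl y≤M)
                  , Star-Shorten-preserves (Linked (RowStep φ)) Linked-merge shortening (column-linked y y ≤-refl y≤M))
                , subst (Initialized φ) (sym e) (no-request-at-point y y≤M)
                , contract-minimal (column y y)
      where
      shortening : Star Shorten (column y y) (contracted y)
      shortening = shorten-contract (column y y)

    contracted-Edge : ∀ y → suc y ≤ M → Edge φ (contracted y) (contracted (suc y))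
    contracted-Edge y y<M with contracted-head (suc y)
    ... | r , e with Succ-resp-≈ (≈-sym (column≈contracted y)) (column-Succ y y ≤-refl y<M)
    ...   | S , succ , S≈column = subst (Edge φ (contracted y)) (sym e)
      ( contracted-vertex y (≤-trans (n≤1+n y) y<M)
      , subst (Vertex φ) e (contracted-vertex (suc y) y<M)
      , S , succ
      , ≈⇒∼ (subst (λ zs → zs ≈ S) e
          (≈-sym (S≈column ◅◅ column≈contracted (suc y)))))

    contracted-reachable : ∀ y → y ≤ M → Reachable φ (contracted 0) (contracted y)
    contracted-reachable zero _ = ε
    contracted-reachable (suc y) y<M =
      contracted-reachable y (≤-trans (n≤1+n y) y<M) ◅◅ (contracted-Edge y y<M ◅ ε)

    length-contracted-0 : length (contracted 0) ≡ 1
    length-contracted-0 = cong (λ m → length (replicate m (L 0 0) ++ [])) (m≤n⇒m⊓n≡m (m≤n+m 1 (rank φ (L 0 0))))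

    contracted-∋ : ∀ {P : Atom φ → Set} x y → x ≤ y → P (L x y) → Σ (Fin (length (contracted y))) (P ∘ lookup (contracted y))
    contracted-∋ {P} x y x≤y px = Any.index any , lookup-index any
      where
      any : Any P (contracted y)
      any = Any-resp-≈ {Pr = P} (column≈contracted y) (column-∋ y y x x≤y px)

  -- From paths in G^min_φ to compass structures

  module _ (K : ℕ) (L : ℕ → ℕ → Atom φ)
           (atom : ∀ x y → x ≤ y → y ≤ K → IsAtom φ (L x y))
           (no-request-at-point : ∀ y → y ≤ K → ∀ ψ → ¬ (⟨D⟩ ψ) ∈ₐ L y y)
           (generated : ∀ x y → x ≤ y → suc y ≤ K → Gen φ (L x y) (L (suc x) (suc y)) (L x (suc y))) where

    private
      D-left : ∀ x d → suc (x + d) ≤ K → L x (suc (x + d)) Dφ L x (x + d)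
      D-left x d y<K = Gen⇒Dˡ {L x (x + d)} {L (suc x) (suc (x + d))} {L x (suc (x + d))}
        (atom x (x + d) (m≤m+n x d) (≤-trans (n≤1+n _) y<K)) (generated x (x + d) (m≤m+n x d) y<K)

      D-right : ∀ x d → suc (x + d) ≤ K → L x (suc (x + d)) Dφ L (suc x) (suc (x + d))
      D-right x d y<K = Gen⇒Dʳ {L x (x + d)} {L (suc x) (suc (x + d))} {L x (suc (x + d))}
        (atom (suc x) (suc (x + d)) (s≤s (m≤m+n x d)) y<K) (generated x (x + d) (m≤m+n x d) y<K)

      D-interval : ∀ d x y → y ≡ x + d → y ≤ K → ∀ x′ y′ → StrictlyInside x y x′ y′ → L x y Dφ L x′ y′
      D-interval zero x y e _ x′ y′ (x≤x′ , x′≤y′ , y′≤y , ≢) rewrite trans e (+-identityʳ x) =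
        ⊥-elim (≢ (≤-antisym (≤-trans x′≤y′ y′≤y) x≤x′ , ≤-antisym y′≤y (≤-trans x≤x′ x′≤y′)))
      D-interval (suc d) x y e y≤K x′ y′ (x≤x′ , x′≤y′ , y′≤y , ≢) with trans e (+-suc x d)
      ... | refl with m≤n⇒m<n∨m≡n y′≤y
      ...   | inj₁ (s≤s y′≤y-1) with inside-or-equal x≤x′ x′≤y′ y′≤y-1
      ...     | inj₁ (refl , refl) = D-left x d y≤K
      ...     | inj₂ inside = D-trans {L x y} {L x (x + d)} {L x′ y′} (D-left x d y≤K)
                                (D-interval d x (x + d) refl (≤-trans (n≤1+n _) y≤K) x′ y′ inside)
      D-interval (suc d) x y e y≤K x′ y′ (x≤x′ , x′≤y′ , y′≤y , ≢) | refl | inj₂ refl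
        with inside-or-equal (≤∧≢⇒< x≤x′ (λ x≡x′ → ≢ (sym x≡x′ , refl))) x′≤y′ ≤-refl
      ...     | inj₁ (refl , _) = D-right x d y≤K
      ...     | inj₂ inside = D-trans {L x y} {L (suc x) y} {L x′ y′} (D-right x d y≤K)
                                (D-interval d (suc x) y refl y≤K x′ y′ inside)

      fulfilling-interval : ∀ d x y → y ≡ x + d → y ≤ K → ∀ ψ → (⟨D⟩ ψ) ∈ₐ L x y →
                            ∃₂ λ x′ y′ → StrictlyInside x y x′ y′ × ψ ∈ₐ L x′ y′
      fulfilling-interval zero x y e y≤K ψ h rewrite trans e (+-identityʳ x) =
        contradiction h (no-request-at-point x y≤K ψ)
      fulfilling-interval (suc d) x y e y≤K ψ h with trans e (+-suc x d)
      ... | refl with to (proj₂ (proj₂ (generated x (x + d) (m≤m+n x d) y≤K)) ψ) h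
      ...   | inj₁ h-left with fulfilling-interval d x (x + d) refl (≤-trans (n≤1+n _) y≤K) ψ h-left
      ...     | x′ , y′ , inside , ψ∈ = x′ , y′ , StrictlyInside-widenʳ inside , ψ∈
      fulfilling-interval (suc d) x y e y≤K ψ h | refl | inj₂ (inj₁ h-right)
        with fulfilling-interval d (suc x) y refl y≤K ψ h-right
      ...     | x′ , y′ , inside , ψ∈ = x′ , y′ , StrictlyInside-widenˡ inside , ψ∈
      fulfilling-interval (suc d) x y e y≤K ψ h | refl | inj₂ (inj₂ (inj₁ (ψ∈ , _))) =
        x , x + d , StrictlyInside-left (m≤m+n x d) , ψ∈
      fulfilling-interval (suc d) x y e y≤K ψ h | refl | inj₂ (inj₂ (inj₂ (ψ∈ , _))) =
        suc x , y , StrictlyInside-right (s≤s (m≤m+n x d)) , ψ∈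

      homogeneous-interval : ∀ d x y → y ≡ x + d → y ≤ K → ∀ p →
                             var p ∈ₐ L x y ⇔ (∀ x′ → x ≤ x′ → x′ ≤ y → var p ∈ₐ L x′ x′)
      homogeneous-interval zero x y e _ p rewrite trans e (+-identityʳ x) =
        mk⇔ (λ h x′ x≤x′ x′≤x → subst (λ z → var p ∈ₐ L z z) (≤-antisym x≤x′ x′≤x) h) (λ h → h x ≤-refl ≤-refl)
      homogeneous-interval (suc d) x y e y≤K p with trans e (+-suc x d)
      ... | refl = ⇔.trans (proj₁ (proj₂ (generated x (x + d) (m≤m+n x d) y≤K)) p)
          (⇔.trans (homogeneous-interval d x (x + d) refl (≤-trans (n≤1+n _) y≤K) p ×-⇔ homogeneous-interval d (suc x) y refl y≤K p)
                   (⇔.sym (∀-interval-split (m≤m+n x d))))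

    generated⇒IsNatCompass : IsNatCompass K L
    generated⇒IsNatCompass = record
      { atom = atom
      ; D-inside = λ x y x′ y′ y≤K inside@(x≤x′ , x′≤y′ , y′≤y , _) →
          D-interval (y ∸ x) x y (sym (m+[n∸m]≡n (≤-trans x≤x′ (≤-trans x′≤y′ y′≤y)))) y≤K x′ y′ inside
      ; fulfilling = λ x y x≤y → fulfilling-interval (y ∸ x) x y (sym (m+[n∸m]≡n x≤y))
      ; homogeneous = λ x y x≤y → homogeneous-interval (y ∸ x) x y (sym (m+[n∸m]≡n x≤y))
      }

  -- Positions beyond the end hold the junk atom ∅; they are never inspected.
  nth : Row → ℕ → Atom φ
  nth [] _ = Vec.replicate _ false
  nth (A ∷ _) zero = A
  nth (_ ∷ xs) (suc i) = nth xs i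

  nth-All : ∀ {P : Atom φ → Set} {xs} → All P xs → ∀ i → i < length xs → P (nth xs i)
  nth-All (p ∷ _) zero _ = p
  nth-All (_ ∷ ps) (suc i) (s≤s i<n) = nth-All ps i i<n

  Any⇒nth : ∀ {P : Atom φ → Set} {xs} → Any P xs → ∃ λ i → i < length xs × P (nth xs i)
  Any⇒nth (here p) = 0 , s≤s z≤n , p
  Any⇒nth (there q) with Any⇒nth q
  ... | i , i<n , p = suc i , s≤s i<n , p

  Succ-length : ∀ {xs A S} → Succ φ xs A S → length S ≡ suc (length xs)
  Succ-length done = refl
  Succ-length (step _ s) = cong suc (Succ-length s)

  Succ-head : ∀ {xs A S} → Succ φ xs A S → nth S 0 ≡ A
  Succ-head done = refl
  Succ-head (step _ _) = refl

  Succ-atoms : ∀ {xs A S} → IsAtom φ A → Succ φ xs A S → All (IsAtom φ) S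
  Succ-atoms atomA done = atomA ∷ []
  Succ-atoms atomA (step g s) = atomA ∷ Succ-atoms (proj₁ g) s

  Succ-Gen : ∀ {xs A S} → Succ φ xs A S → ∀ i → i < length xs → Gen φ (nth xs i) (nth S i) (nth S (suc i))
  Succ-Gen (step {R = R} {A = A} g s) zero _ = subst (Gen φ R A) (sym (Succ-head s)) g
  Succ-Gen (step _ s) (suc i) (s≤s i<n) = Succ-Gen s i i<n

  record Triangle (K : ℕ) : Set where
    field
      column : ℕ → Row
      length-column : ∀ y → y ≤ K → length (column y) ≡ suc y
      column-atoms : ∀ y → y ≤ K → All (IsAtom φ) (column y)
      column-initialized : ∀ y → y ≤ K → Initialized φ (column y)
      column-Succ : ∀ y → suc y ≤ K → ∃ λ A → Succ φ (column y) A (column (suc y))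

  module _ {K} (t : Triangle K) where

    open Triangle t

    labelling : ℕ → ℕ → Atom φ
    labelling x y = nth (column y) (y ∸ x)

    Triangle⇒IsNatCompass : IsNatCompass K labelling
    Triangle⇒IsNatCompass = generated⇒IsNatCompass K labelling atom no-request-at-point generated
      where
      in-range : ∀ x y → y ≤ K → y ∸ x < length (column y)
      in-range x y y≤K = subst (y ∸ x <_) (sym (length-column y y≤K)) (s≤s (m∸n≤m y x))

      atom : ∀ x y → x ≤ y → y ≤ K → IsAtom φ (labelling x y)
      atom x y _ y≤K = nth-All (column-atoms y y≤K) (y ∸ x) (in-range x y y≤K)

      no-request-at-point : ∀ y → y ≤ K → ∀ ψ → ¬ (⟨D⟩ ψ) ∈ₐ labelling y y
      no-request-at-point y y≤K rewrite n∸n≡0 y = head-unrequesting (column y) (column-initialized y y≤K)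
        where
        head-unrequesting : ∀ xs → Initialized φ xs → ∀ ψ → ¬ (⟨D⟩ ψ) ∈ₐ nth xs 0
        head-unrequesting (_ ∷ _) init = init

      generated : ∀ x y → x ≤ y → suc y ≤ K → Gen φ (labelling x y) (labelling (suc x) (suc y)) (labelling x (suc y))
      generated x y x≤y y<K with column-Succ y y<K
      ... | _ , s = subst (λ i → Gen φ (labelling x y) (labelling (suc x) (suc y)) (nth (column (suc y)) i))
                      (sym (+-∸-assoc 1 x≤y)) (Succ-Gen s (y ∸ x) (in-range x y (≤-trans (n≤1+n y) y<K)))

  private
    ≤-suc-cases : ∀ {y K} → y ≤ suc K → y ≤ K ⊎ y ≡ suc K
    ≤-suc-cases = Sum.map₁ ≤-pred ∘ m≤n⇒m<n∨m≡n

  extend-column : (ℕ → Row) → ℕ → Row → ℕ → Row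
  extend-column column K S y with y ℕ.≟ suc K
  ... | yes _ = S
  ... | no _ = column y

  extend-column-old : ∀ column K S y → y ≤ K → extend-column column K S y ≡ column y
  extend-column-old column K S y y≤K with y ℕ.≟ suc K
  ... | yes refl = contradiction refl (<⇒≢ (s≤s y≤K))
  ... | no _ = refl

  extend-column-new : ∀ column K S → extend-column column K S (suc K) ≡ S
  extend-column-new column K S with suc K ℕ.≟ suc K
  ... | yes _ = refl
  ... | no K+1≢K+1 = ⊥-elim (K+1≢K+1 refl)

  Triangle-extend : ∀ {K A S} (t : Triangle K) → IsAtom φ A → (∀ ψ → ¬ (⟨D⟩ ψ) ∈ₐ A) →
                    Succ φ (Triangle.column t K) A S → Triangle (suc K)
  Triangle-extend {K} {A} {S} t atomA initA s = record
    { column = column′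
    ; length-column = λ y y≤K+1 → case-on y y≤K+1 (λ y xs → length xs ≡ suc y) (length-column y)
        (trans (Succ-length s) (cong suc (length-column K ≤-refl)))
    ; column-atoms = λ y y≤K+1 → case-on y y≤K+1 (λ _ → All (IsAtom φ)) (column-atoms y) (Succ-atoms atomA s)
    ; column-initialized = λ y y≤K+1 → case-on y y≤K+1 (λ _ → Initialized φ) (column-initialized y)
        (S-initialized s)
    ; column-Succ = λ y y<K+1 → Succ-step y y<K+1
    }
    where
    open Triangle t

    column′ : ℕ → Row
    column′ = extend-column column K S
    column′-old : ∀ y → y ≤ K → column′ y ≡ column y
    column′-old = extend-column-old column K S
    column′-new : column′ (suc K) ≡ S
    column′-new = extend-column-new column K S

    case-on : ∀ y → y ≤ suc K → (P : ℕ → Row → Set) → (y ≤ K → P y (column y)) → P (suc K) S → P y (column′ y)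
    case-on y y≤K+1 P old new with ≤-suc-cases y≤K+1
    ... | inj₁ y≤K = subst (P y) (sym (column′-old y y≤K)) (old y≤K)
    ... | inj₂ refl = subst (P (suc K)) (sym column′-new) new

    S-initialized : ∀ {xs S} → Succ φ xs A S → Initialized φ S
    S-initialized done = initA
    S-initialized (step _ _) = initA

    Succ-step : ∀ y → suc y ≤ suc K → ∃ λ B → Succ φ (column′ y) B (column′ (suc y))
    Succ-step y (s≤s y≤K) with ≤-suc-cases (s≤s y≤K)
    ... | inj₁ y<K = subst₂ (λ xs ys → ∃ λ B → Succ φ xs B ys)
                       (sym (column′-old y (≤-trans (n≤1+n y) y<K))) (sym (column′-old (suc y) y<K)) (column-Succ y y<K)
    ... | inj₂ refl = A , subst₂ (λ xs ys → Succ φ xs A ys) (sym (column′-old K ≤-refl)) (sym column′-new) s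

  Triangle-initial : ∀ {A} → IsAtom φ A → (∀ ψ → ¬ (⟨D⟩ ψ) ∈ₐ A) → Triangle 0
  Triangle-initial {A} atomA initA = record
    { column = λ _ → A ∷ []
    ; length-column = λ { zero z≤n → refl }
    ; column-atoms = λ _ _ → atomA ∷ []
    ; column-initialized = λ _ _ → initA
    ; column-Succ = λ _ ()
    }

  path⇒Triangle : ∀ {K r r₂} (t : Triangle K) → Triangle.column t K ≈ r → Reachable φ r r₂ →
                  ∃ λ K′ → Σ (Triangle K′) λ t′ → Triangle.column t′ K′ ≈ r₂
  path⇒Triangle t column≈r ε = _ , t , column≈r
  path⇒Triangle t _ (_◅_ {j = []} (_ , ((() , _) , _)) _)
  path⇒Triangle {K} t column≈r (_◅_ {j = A ∷ r′} (_ , ((_ , atomA ∷ _ , _) , initA , _) , S , s , A∷r′∼S) edges)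
    with Succ-resp-≈ column≈r s
  ... | S′ , s′ , S′≈S = path⇒Triangle (Triangle-extend t atomA initA s′)
          (subst (λ xs → xs ≈ A ∷ r′) (sym (extend-column-new (Triangle.column t) K S′))
            (S′≈S ◅◅ ≈-sym (∼⇒≈ A∷r′∼S)))
          edges

  HasModel : Set
  HasModel = ∃[ N ] Σ (Labelling φ N) (λ L → IsCompass φ L × Homogeneous φ L × Fulfilling φ L × Features φ L φ)

  HasPath : Set
  HasPath = Σ (List (Atom φ)) λ row₁ → Σ (List (Atom φ)) λ row₂ →
              Vertex φ row₁ × Vertex φ row₂ × (length row₁ ≡ 1)
            × (Σ (Fin (length row₂)) λ i → φ ∈ₐ lookup row₂ i) × Reachable φ row₁ row₂

  natModel⇒path : ∀ M L → IsNatCompass M L → ∀ {x y} → x ≤ y → y ≤ M → φ ∈ₐ L x y → HasPath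
  natModel⇒path M L nat {x} {y} x≤y y≤M φ∈ =
    contracted 0 , contracted y , contracted-vertex 0 z≤n , contracted-vertex y y≤M ,
    length-contracted-0 , contracted-∋ {φ ∈ₐ_} x y x≤y φ∈ , contracted-reachable y y≤M
    where open Columns M L nat

  model⇒path : HasModel → HasPath
  model⇒path (zero , _ , _ , _ , _ , () , _)
  model⇒path (suc M , L , compass , hom , ful , features) =
    let (x , y , x≤y , y≤M , φ∈) = Features-extend M L compass hom ful {φ} features in
    natModel⇒path M (extendLabelling M L) (Compass⇒IsNatCompass M L compass hom ful) x≤y y≤M φ∈

  triangle⇒model : ∀ {row} → (∃ λ K → Σ (Triangle K) λ t → Triangle.column t K ≈ row) →
                   Any (φ ∈ₐ_) row → HasModel
  triangle⇒model (K , t , column≈row) φ∈row with Any⇒nth (Any-resp-≈ (≈-sym column≈row) φ∈row)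
  ... | j , j<K+1 , φ∈column =
    let (compass , hom , ful) = IsNatCompass⇒Compass K (labelling t) nat in
    suc K , restrictLabelling K (labelling t) , compass , hom , ful ,
    Features-restrict K (labelling t) nat {φ} (m∸n≤m K j) ≤-refl
      (subst (λ k → φ ∈ₐ nth (Triangle.column t K) k) (sym (m∸[m∸n]≡n j≤K)) φ∈column)
    where
    nat : IsNatCompass K (labelling t)
    nat = Triangle⇒IsNatCompass t
    j≤K : j ≤ K
    j≤K = ≤-pred (subst (j <_) (Triangle.length-column t K ≤-refl) j<K+1)

  path⇒model : HasPath → HasModel
  path⇒model (A ∷ [] , row₂ , ((_ , atomA ∷ _ , _) , initA , _) , _ , refl , (i , φ∈) , path) =
    triangle⇒model (path⇒Triangle (Triangle-initial atomA initA) ε path) (lose (∈-lookup i) φ∈)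

theorem3p16 : ∀ {n : ℕ} (φ : Formula n) →
  (∃[ N ] Σ (Labelling φ N) (λ L →
      IsCompass φ L × Homogeneous φ L × Fulfilling φ L × Features φ L φ))
  ⇔
  (Σ (List (Atom φ)) λ row₁ → Σ (List (Atom φ)) λ row₂ →
      Vertex φ row₁ × Vertex φ row₂
    × (length row₁ ≡ 1)
    × (Σ (Fin (length row₂)) λ i → _∈A_ φ φ (lookup row₂ i))
    × Reachable φ row₁ row₂)
theorem3p16 φ = mk⇔ (model⇒path φ) (path⇒model φ)
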